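{- Let $E=\{(0,2),(0,3),(2,0),(2,2),(2,3),(3,0),(3,2),(3,3)\}$. For each of the following sets $T$, with $R=E\cup T$, we have $(123,R)\sim_d(132,R)$: (1) $T=\{(0,0)\}$; (2) $T=\{(0,1),(1,0)\}$; (3) $T=\{(0,0),(0,1),(1,0)\}$; (4) $T=\{(1,1)\}$; (5) $T=\{(0,0),(1,1)\}$; (6) $T=\{(0,1),(1,0),(1,1)\}$; (7) $T=\{(0,0),(0,1),(1,0),(1,1)\}$.
   Context: $S_n$ denotes the set of permutations of $[n]=\{1,\dots,n\}$, written $\pi=\pi_1\cdots\pi_n$. A mesh pattern of length $k$ is a pair $(\tau,R)$ with $\tau\in S_k$ and $R\subseteq\{0,1,\dots,k\}^2$ (the shaded boxes; box $(a,b)$ is the unit square $[a,a+1]\times[b,b+1]$ in the diagram of $\tau$). An occurrence of $(\tau,R)$ in $\pi\in S_n$ is a choice of indices $i_1<\dots<i_k$ such that $\pi_{i_1}\cdots\pi_{i_k}$ is order-isomorphic to $\tau$ and, with $i_0=0$, $i_{k+1}=n+1$, $v_1<\dots<v_k$ the values $\pi_{i_1},\dots,\pi_{i_k}$ sorted increasingly, $v_0=0$, $v_{k+1}=n+1$, for every $(a,b)\in R$ there is no index $m$ with $i_a<m<i_{a+1}$ and $v_b<\pi_m<v_{b+1}$. Mesh patterns $p,q$ are equidistributed, $p\sim_d q$, if for all $n,\ell\ge0$ the number of $\pi\in S_n$ with exactly $\ell$ occurrences of $p$ equals the number with exactly $\ell$ occurrences of $q$. -}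

module Defs where

open import Data.Nat using (ℕ; zero; suc; _+_; _≡ᵇ_; _<ᵇ_; _≤ᵇ_)
open import Data.Bool using (Bool; true; false; _∧_; _∨_; not; if_then_else_)
open import Data.List using (List; []; _∷_; _++_; map; filter; length; concatMap)
open import Data.Bool.ListAction using (all; any)
open import Data.Bool using (T?)
import Data.Nat as ℕ
open import Data.Product using (_×_; _,_)
open import Data.Fin using (Fin; toℕ)
open import Data.Vec using (Vec)
open import Relation.Binary.PropositionalEquality using (_≡_)
open import Relation.Nullary.Decidable using (does)

_==ᴮ_ : Bool → Bool → Bool
true  ==ᴮ b = b
false ==ᴮ b = not b

range1 : ℕ → List ℕ
range1 zero    = []
range1 (suc n) = range1 n ++ (suc n ∷ [])

-- 0-based lookup with default 0
nth : List ℕ → ℕ → ℕ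
nth []       _       = 0
nth (x ∷ xs) zero    = x
nth (x ∷ xs) (suc i) = nth xs i

indices : ℕ → List ℕ
indices zero    = []
indices (suc n) = indices n ++ (n ∷ [])

elem : ℕ → List ℕ → Bool
elem x = any (λ y → x ≡ᵇ y)

distinct : List ℕ → Bool
distinct []       = true
distinct (x ∷ xs) = not (elem x xs) ∧ distinct xs

words : List ℕ → ℕ → List (List ℕ)
words as zero    = [] ∷ []
words as (suc m) = concatMap (λ a → map (a ∷_) (words as m)) as

-- S_n: permutations of [n] in one-line notation π₁⋯πₙ
Sn : ℕ → List (List ℕ)
Sn n = filter (λ w → T? (distinct w)) (words (range1 n) n)

-- all k-element subsets of a list, as sublists in the original order
choose : ℕ → List ℕ → List (List ℕ)
choose zero    _        = [] ∷ []
choose (suc k) []       = []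
choose (suc k) (x ∷ xs) = map (x ∷_) (choose k xs) ++ choose (suc k) xs

insert : ℕ → List ℕ → List ℕ
insert x []       = x ∷ []
insert x (y ∷ ys) = if x ≤ᵇ y then x ∷ y ∷ ys else y ∷ insert x ys

sort : List ℕ → List ℕ
sort []       = []
sort (x ∷ xs) = insert x (sort xs)

-- A mesh pattern (τ, R): τ ∈ S_k in one-line notation, R the shaded boxes.
record MeshPattern : Set where
  constructor mesh
  field
    k   : ℕ
    τ   : List ℕ
    R   : List (ℕ × ℕ)

open MeshPattern public

-- Is the increasing index tuple is = i₁ < ⋯ < iₖ (1-based) an occurrence of p in π?
isOccurrence : MeshPattern → List ℕ → List ℕ → Bool
isOccurrence p π is = orderIso ∧ all boxOK (R p)
  where
    n   = length π
    πat : ℕ → ℕ                 -- π_m for 1 ≤ m ≤ n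
    πat zero    = 0
    πat (suc m) = nth π m
    ws  = map πat is
    ks  = indices (k p)
    orderIso : Bool
    orderIso = all (λ a → all (λ b →
                 (nth ws a <ᵇ nth ws b) ==ᴮ (nth (τ p) a <ᵇ nth (τ p) b)) ks) ks
    iExt = 0 ∷ (is ++ (suc n ∷ []))
    vExt = 0 ∷ (sort ws ++ (suc n ∷ []))
    boxOK : ℕ × ℕ → Bool
    boxOK (a , b) = not (any (λ m →
        (nth iExt a <ᵇ m) ∧ (m <ᵇ nth iExt (suc a)) ∧
        (nth vExt b <ᵇ πat m) ∧ (πat m <ᵇ nth vExt (suc b))) (range1 n))

occ : MeshPattern → List ℕ → ℕ
occ p π = length (filter (λ is → T? (isOccurrence p π is))
                         (choose (k p) (range1 (length π))))

countWith : MeshPattern → ℕ → ℕ → ℕ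
countWith p n ℓ = length (filter (λ π → occ p π ℕ.≟ ℓ) (Sn n))

_∼d_ : MeshPattern → MeshPattern → Set
p ∼d q = ∀ (n ℓ : ℕ) → countWith p n ℓ ≡ countWith q n ℓ

E : List (ℕ × ℕ)
E = (0 , 2) ∷ (0 , 3) ∷ (2 , 0) ∷ (2 , 2) ∷ (2 , 3) ∷ (3 , 0) ∷ (3 , 2) ∷ (3 , 3) ∷ []

p123 : List (ℕ × ℕ) → MeshPattern
p123 T = mesh 3 (1 ∷ 2 ∷ 3 ∷ []) (E ++ T)

p132 : List (ℕ × ℕ) → MeshPattern
p132 T = mesh 3 (1 ∷ 3 ∷ 2 ∷ []) (E ++ T)

Ts : List (List (ℕ × ℕ))
Ts = ((0 , 0) ∷ [])
   ∷ ((0 , 1) ∷ (1 , 0) ∷ [])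
   ∷ ((0 , 0) ∷ (0 , 1) ∷ (1 , 0) ∷ [])
   ∷ ((1 , 1) ∷ [])
   ∷ ((0 , 0) ∷ (1 , 1) ∷ [])
   ∷ ((0 , 1) ∷ (1 , 0) ∷ (1 , 1) ∷ [])
   ∷ ((0 , 0) ∷ (0 , 1) ∷ (1 , 0) ∷ (1 , 1) ∷ [])
   ∷ []

-- Fix positions i < j of π ∈ S_n, with values a = π_i and b = π_j, and let S be the part of π after
-- position j. At most one occurrence of (123, E ∪ T) starts at i, j, and there is one iff b is the
-- second largest entry of b S, all entries of S exceed a, and the boxes left of j are empty for the
-- values a < t with t = b. Likewise at most one occurrence of (132, E ∪ T) starts at i, j, and there
-- is one iff b is the largest entry of b S, S is nonempty, and the same conditions hold with t the
-- largest entry of S. In both cases t is the second largest entry of b S, and whether the boxes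
-- left of j are empty only depends on the entries ≤ t and on which entries exceed t.
-- The map Φ rebuilds π from the right: an entry larger than the second largest entry of the
-- rebuilt tail trades places with the largest entry of that tail. Φ is an involution on S_n. At
-- every position it turns a suffix headed by its second largest entry into one headed by its
-- largest entry and vice versa, keeping the second largest entry t, and it changes the entries in
-- front of the suffix only above t. So Φ matches occurrences of (123, E ∪ T) in π with occurrences
-- of (132, E ∪ T) in Φ π, position pair by position pair.

module Submission where

open import Defs
open import Data.Bool using (Bool; true; false; _∧_; _∨_; not; if_then_else_; T; T?)
open import Data.Bool.ListAction using (all; any)
open import Data.Bool.Properties using (T-≡; ∧-conicalˡ; ∧-zeroʳ; ∧-identityʳ; ∨-identityʳ; ∧-assoc; ∧-comm; ∨-assoc)
open import Data.Bool.Solver using (module ∨-∧-Solver)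
open import Data.Empty using (⊥-elim)
open import Data.List using (List; []; _∷_; [_]; _++_; map; length; filter; concatMap)
open import Data.List.Membership.Propositional using (_∈_; _∉_; find; lose)
open import Data.List.Membership.Propositional.Properties
  using (∈-∃++; ∈-++⁺ˡ; ∈-++⁺ʳ; ∈-map⁺; ∈-map⁻; ∈-concatMap⁺; ∈-concatMap⁻; ∈-filter⁺; ∈-filter⁻)
open import Data.List.Membership.Propositional.Properties.WithK using (unique∧set⇒bag)
open import Data.List.Properties using (++-assoc; ++-identityʳ; length-++; map-++; ∷-injectiveʳ)
open import Data.List.Relation.Binary.BagAndSetEquality using (∼bag⇒↭)
open import Data.List.Relation.Binary.Permutation.Propositional using (_↭_; prep; swap; ↭-sym; ↭-refl)
import Data.List.Relation.Binary.Permutation.Propositional as ↭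
open import Data.List.Relation.Binary.Permutation.Propositional.Properties using (shift; ∈-resp-↭; ↭-length)
import Data.List.Relation.Binary.Permutation.Propositional.Properties as ↭
import Data.List.Relation.Binary.Permutation.Setoid.Properties as ↭ₛ
open import Data.List.Relation.Binary.Pointwise using (Pointwise; []; _∷_)
import Data.List.Relation.Binary.Pointwise as Pointwise
open import Data.List.Relation.Unary.All using (All; []; _∷_)
import Data.List.Relation.Unary.All as All
open import Data.List.Relation.Unary.All.Properties using (All¬⇒¬Any; ¬Any⇒All¬)
import Data.List.Relation.Unary.All.Properties as All
open import Data.List.Relation.Unary.Any using (here; there)
open import Data.List.Relation.Unary.Unique.Propositional using (Unique; []; _∷_)
import Data.List.Relation.Unary.Unique.Propositional.Properties as Unique
open import Data.Nat using (ℕ; zero; suc; _+_; _≤_; _<_; z≤n; s≤s; _⊔_; _⊓_; _≡ᵇ_; _<ᵇ_; _≤ᵇ_; _≟_)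
open import Data.Nat.Properties
open import Data.Product using (_×_; _,_; proj₁; proj₂; ∃)
open import Data.Sum using (_⊎_; inj₁; inj₂)
open import Function using (_∘_; id)
open import Function.Bundles using (mk⇔; Equivalence)
open import Relation.Binary.Definitions using (tri<; tri≈; tri>)
open import Relation.Binary.PropositionalEquality hiding ([_])
open import Relation.Nullary using (yes; no; ¬_; does; _×-dec_)
open import Relation.Nullary.Decidable using (toWitness)
open import Relation.Unary using (Decidable)

<ᵇ-true : ∀ {m n} → m < n → (m <ᵇ n) ≡ true
<ᵇ-true m<n = Equivalence.to T-≡ (<⇒<ᵇ m<n)

<ᵇ-true⁻ : ∀ {m n} → (m <ᵇ n) ≡ true → m < n
<ᵇ-true⁻ {m} {n} eq = <ᵇ⇒< m n (Equivalence.from T-≡ eq)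

<ᵇ-false : ∀ {m n} → n ≤ m → (m <ᵇ n) ≡ false
<ᵇ-false {m} {n} n≤m with m <ᵇ n in eq
... | false = refl
... | true  = ⊥-elim (<⇒≱ (<ᵇ-true⁻ {m} {n} eq) n≤m)

<ᵇ-false⁻ : ∀ {m n} → (m <ᵇ n) ≡ false → n ≤ m
<ᵇ-false⁻ {m} {n} eq = ≮⇒≥ (λ m<n → subst T eq (<⇒<ᵇ m<n))

<ᵇ-trans : ∀ x y z → (x <ᵇ y) ≡ true → (y <ᵇ z) ≡ true → (x <ᵇ z) ≡ true
<ᵇ-trans x y z x<y y<z = <ᵇ-true (<-trans (<ᵇ-true⁻ {x} {y} x<y) (<ᵇ-true⁻ {y} {z} y<z))

≮ᵇ-trans : ∀ x y z → (x <ᵇ y) ≡ false → (y <ᵇ z) ≡ false → (x <ᵇ z) ≡ false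
≮ᵇ-trans x y z x≮y y≮z = <ᵇ-false (≤-trans (<ᵇ-false⁻ {y} {z} y≮z) (<ᵇ-false⁻ {x} {y} x≮y))

<ᵇ-flip : ∀ {x y} → x ≢ y → (y <ᵇ x) ≡ not (x <ᵇ y)
<ᵇ-flip {x} {y} x≢y with <-cmp x y
... | tri< x<y _ _ rewrite <ᵇ-true x<y | <ᵇ-false {y} (<⇒≤ x<y) = refl
... | tri≈ _ x≡y _ = ⊥-elim (x≢y x≡y)
... | tri> _ _ y<x rewrite <ᵇ-true y<x | <ᵇ-false {x} (<⇒≤ y<x) = refl

≤ᵇ-true : ∀ {m n} → m ≤ n → (m ≤ᵇ n) ≡ true
≤ᵇ-true m≤n = Equivalence.to T-≡ (≤⇒≤ᵇ m≤n)

≤ᵇ-false : ∀ {m n} → n < m → (m ≤ᵇ n) ≡ false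
≤ᵇ-false {m} {n} n<m with m ≤ᵇ n in eq
... | false = refl
... | true  = ⊥-elim (<⇒≱ n<m (≤ᵇ⇒≤ m n (Equivalence.from T-≡ eq)))

≡ᵇ-true : ∀ {m n} → m ≡ n → (m ≡ᵇ n) ≡ true
≡ᵇ-true {m} {n} m≡n = Equivalence.to T-≡ (≡⇒≡ᵇ m n m≡n)

≡ᵇ-false : ∀ {m n} → m ≢ n → (m ≡ᵇ n) ≡ false
≡ᵇ-false {m} {n} m≢n with m ≡ᵇ n in eq
... | false = refl
... | true  = ⊥-elim (m≢n (≡ᵇ⇒≡ m n (Equivalence.from T-≡ eq)))

∧-implied : ∀ h {q} → (h ≡ true → q ≡ true) → ∀ p r → p ∧ (h ∧ r) ≡ p ∧ (h ∧ (q ∧ r))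
∧-implied false _  p r = refl
∧-implied true  h⇒q p r rewrite h⇒q refl = refl

Unique-resp-↭ : ∀ {A : Set} {xs ys : List A} → xs ↭ ys → Unique xs → Unique ys
Unique-resp-↭ {A} p = ↭ₛ.Unique-resp-↭ (setoid A) (↭.↭⇒↭ₛ p)

Unique-++⁻ʳ : ∀ {A : Set} (P : List A) {W} → Unique (P ++ W) → Unique W
Unique-++⁻ʳ []      u       = u
Unique-++⁻ʳ (_ ∷ P) (_ ∷ u) = Unique-++⁻ʳ P u

∉-middle : ∀ {A : Set} (pre : List A) {M} post → Unique (pre ++ M ∷ post) → M ∉ pre ++ post
∉-middle pre post u with Unique-resp-↭ (shift _ pre post) u
... | M∉ ∷ _ = All¬⇒¬Any M∉

Unique-map : ∀ {A B : Set} {f : A → B} {xs} → Unique xs → (∀ {x y} → x ∈ xs → y ∈ xs → f x ≡ f y → x ≡ y) →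
             Unique (map f xs)
Unique-map []       _   = []
Unique-map (x∉ ∷ u) inj =
  All.map⁺ (All.tabulate (λ y∈ fx≡fy → All.lookup x∉ y∈ (inj (here refl) (there y∈) fx≡fy)))
  ∷ Unique-map u (λ x∈ y∈ → inj (there x∈) (there y∈))

all-↭ : ∀ {A : Set} (f : A → Bool) {xs ys} → xs ↭ ys → all f xs ≡ all f ys
all-↭ f ↭.refl        = refl
all-↭ f (prep x p)    = cong (f x ∧_) (all-↭ f p)
all-↭ f (swap {xs} {ys} x y p) = begin
  f x ∧ (f y ∧ all f xs) ≡⟨ sym (∧-assoc (f x) (f y) _) ⟩
  (f x ∧ f y) ∧ all f xs ≡⟨ cong₂ _∧_ (∧-comm (f x) (f y)) (all-↭ f p) ⟩
  (f y ∧ f x) ∧ all f ys ≡⟨ ∧-assoc (f y) (f x) _ ⟩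
  f y ∧ (f x ∧ all f ys) ∎
  where open ≡-Reasoning
all-↭ f (↭.trans p q) = trans (all-↭ f p) (all-↭ f q)

all-++ : ∀ {A : Set} (f : A → Bool) P Q → all f (P ++ Q) ≡ all f P ∧ all f Q
all-++ f []      Q = refl
all-++ f (x ∷ P) Q = trans (cong (f x ∧_) (all-++ f P Q)) (sym (∧-assoc (f x) _ _))

any-++ : ∀ {A : Set} (f : A → Bool) xs ys → any f (xs ++ ys) ≡ any f xs ∨ any f ys
any-++ f []       ys = refl
any-++ f (x ∷ xs) ys = trans (cong (f x ∨_) (any-++ f xs ys)) (sym (∨-assoc (f x) _ _))

all-cong-∈ : ∀ {A : Set} {f h : A → Bool} xs → (∀ {x} → x ∈ xs → f x ≡ h x) → all f xs ≡ all h xs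
all-cong-∈ []       _   = refl
all-cong-∈ (x ∷ xs) f≗h = cong₂ _∧_ (f≗h (here refl)) (all-cong-∈ xs (f≗h ∘ there))

any-cong-∈ : ∀ {A : Set} {f h : A → Bool} xs → (∀ {x} → x ∈ xs → f x ≡ h x) → any f xs ≡ any h xs
any-cong-∈ []       _   = refl
any-cong-∈ (x ∷ xs) f≗h = cong₂ _∨_ (f≗h (here refl)) (any-cong-∈ xs (f≗h ∘ there))

any-false : ∀ {A : Set} {f : A → Bool} xs → (∀ {x} → x ∈ xs → f x ≡ false) → any f xs ≡ false
any-false []       _     = refl
any-false (x ∷ xs) f≗false rewrite f≗false (here refl) = any-false xs (f≗false ∘ there)

not-any : ∀ {A : Set} (f : A → Bool) L → not (any f L) ≡ all (not ∘ f) L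
not-any f []      = refl
not-any f (x ∷ L) with f x
... | true  = refl
... | false = not-any f L

all-∧ : ∀ {A : Set} (f h : A → Bool) L → all f L ∧ all h L ≡ all (λ v → f v ∧ h v) L
all-∧ f h []      = refl
all-∧ f h (x ∷ L) = trans (solve 4 (λ p q r s → (p :* q) :* (r :* s) := (p :* r) :* (q :* s)) refl (f x) _ (h x) _)
                          (cong ((f x ∧ h x) ∧_) (all-∧ f h L))
  where open ∨-∧-Solver

nonEmpty : ∀ {A : Set} → List A → Bool
nonEmpty []      = false
nonEmpty (_ ∷ _) = true

nonEmpty-↭ : ∀ {A : Set} {xs : List A} {y ys} → xs ↭ y ∷ ys → nonEmpty xs ≡ true
nonEmpty-↭ {xs = []}    p with () ← ↭-length p
nonEmpty-↭ {xs = _ ∷ _} _ = refl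

Pointwise-∈ : ∀ {A B : Set} {R : A → B → Set} {U V u} → Pointwise R U V → u ∈ U → ∃ λ u′ → u′ ∈ V × R u u′
Pointwise-∈ (r ∷ _)   (here refl) = _ , here refl , r
Pointwise-∈ (_ ∷ U~V) (there u∈U) with Pointwise-∈ U~V u∈U
... | u′ , u′∈V , r = u′ , there u′∈V , r

Pointwise-++⁻ : ∀ {A B : Set} {R : A → B → Set} X {Y Z} → Pointwise R (X ++ Y) Z →
  ∃ λ X′ → ∃ λ Y′ → Z ≡ X′ ++ Y′ × Pointwise R X X′ × Pointwise R Y Y′
Pointwise-++⁻ []      Y~Z = [] , _ , refl , [] , Y~Z
Pointwise-++⁻ (x ∷ X) (r ∷ XY~Z) with Pointwise-++⁻ X XY~Z
... | X′ , Y′ , Z≡ , X~X′ , Y~Y′ = _ ∷ X′ , Y′ , cong (_ ∷_) Z≡ , r ∷ X~X′ , Y~Y′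

split-at : ∀ {A : Set} (l : List A) k → k < length l → ∃ λ X → ∃ λ x → ∃ λ Y → l ≡ X ++ x ∷ Y × length X ≡ k
split-at (y ∷ l) zero    _         = [] , y , l , refl , refl
split-at (y ∷ l) (suc k) (s≤s k<l) with split-at l k k<l
... | X , x , Y , l≡ , refl = y ∷ X , x , Y , cong (y ∷_) l≡ , refl

nth-++ : ∀ X y Z → nth (X ++ y ∷ Z) (length X) ≡ y
nth-++ []      y Z = refl
nth-++ (x ∷ X) y Z = nth-++ X y Z

length-snoc : ∀ {A : Set} (X : List A) y → length (X ++ [ y ]) ≡ suc (length X)
length-snoc X y = trans (length-++ X) (+-comm (length X) 1)

↭-pull-three : ∀ {X : Set} (A : List X) a B b C c D → A ++ a ∷ B ++ b ∷ C ++ c ∷ D ↭ a ∷ b ∷ c ∷ ((A ++ B) ++ C) ++ D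
↭-pull-three A a B b C c D = begin
  A ++ a ∷ B ++ b ∷ C ++ c ∷ D      ↭⟨ shift a A _ ⟩
  a ∷ A ++ B ++ b ∷ C ++ c ∷ D      ≡⟨ cong (a ∷_) (sym (++-assoc A B _)) ⟩
  a ∷ (A ++ B) ++ b ∷ C ++ c ∷ D    ↭⟨ prep a (shift b (A ++ B) _) ⟩
  a ∷ b ∷ (A ++ B) ++ C ++ c ∷ D    ≡⟨ cong (λ l → a ∷ b ∷ l) (sym (++-assoc (A ++ B) C _)) ⟩
  a ∷ b ∷ ((A ++ B) ++ C) ++ c ∷ D  ↭⟨ prep a (prep b (shift c ((A ++ B) ++ C) D)) ⟩
  a ∷ b ∷ c ∷ ((A ++ B) ++ C) ++ D  ∎
  where open ↭.PermutationReasoning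

indicator : Bool → ℕ
indicator true  = 1
indicator false = 0

count : ∀ {A : Set} → (A → Bool) → List A → ℕ
count f []       = 0
count f (x ∷ xs) = indicator (f x) + count f xs

count-++ : ∀ {A : Set} (f : A → Bool) l l′ → count f (l ++ l′) ≡ count f l + count f l′
count-++ f []      l′ = refl
count-++ f (x ∷ l) l′ = trans (cong (indicator (f x) +_) (count-++ f l l′)) (sym (+-assoc (indicator (f x)) _ _))

count-map : ∀ {A B : Set} (f : B → Bool) (h : A → B) l → count f (map h l) ≡ count (f ∘ h) l
count-map f h []      = refl
count-map f h (x ∷ l) = cong (indicator (f (h x)) +_) (count-map f h l)

count-filter : ∀ {A : Set} (f : A → Bool) l → length (filter (λ x → T? (f x)) l) ≡ count f l
count-filter f []      = refl
count-filter f (x ∷ l) with f x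
... | true  = cong suc (count-filter f l)
... | false = count-filter f l

length-filter-map : ∀ {A B : Set} {P : B → Set} (P? : Decidable P) (f : A → B) xs →
  length (filter P? (map f xs)) ≡ length (filter (P? ∘ f) xs)
length-filter-map P? f []       = refl
length-filter-map P? f (x ∷ xs) with does (P? (f x))
... | true  = cong suc (length-filter-map P? f xs)
... | false = length-filter-map P? f xs

length-filter-cong : ∀ {A : Set} (f h : A → ℕ) ℓ xs → (∀ {x} → x ∈ xs → f x ≡ h x) →
  length (filter (λ x → f x ≟ ℓ) xs) ≡ length (filter (λ x → h x ≟ ℓ) xs)
length-filter-cong f h ℓ []       _   = refl
length-filter-cong f h ℓ (x ∷ xs) f≗h rewrite f≗h (here refl) with h x ≡ᵇ ℓ
... | true  = cong suc (length-filter-cong f h ℓ xs (f≗h ∘ there))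
... | false = length-filter-cong f h ℓ xs (f≗h ∘ there)

map-involution-↭ : ∀ {A : Set} {f : A → A} {xs} → Unique xs → (∀ {x} → x ∈ xs → f x ∈ xs) →
                   (∀ {x} → x ∈ xs → f (f x) ≡ x) → map f xs ↭ xs
map-involution-↭ {f = f} {xs} u closed involutive =
  ∼bag⇒↭ (unique∧set⇒bag (Unique-map u injective) u (mk⇔ to from))
  where
    injective : ∀ {x y} → x ∈ xs → y ∈ xs → f x ≡ f y → x ≡ y
    injective x∈ y∈ fx≡fy = trans (sym (involutive x∈)) (trans (cong f fx≡fy) (involutive y∈))
    to : ∀ {y} → y ∈ map f xs → y ∈ xs
    to y∈ with ∈-map⁻ f y∈
    ... | x , x∈ , refl = closed x∈
    from : ∀ {y} → y ∈ xs → y ∈ map f xs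
    from y∈ = subst (_∈ map f xs) (involutive y∈) (∈-map⁺ f (closed y∈))

interval : ℕ → ℕ → List ℕ
interval s zero    = []
interval s (suc c) = s ∷ interval (suc s) c

interval-snoc : ∀ s c → interval s (suc c) ≡ interval s c ++ [ s + c ]
interval-snoc s zero    = cong [_] (sym (+-identityʳ s))
interval-snoc s (suc c) =
  cong (s ∷_) (trans (interval-snoc (suc s) c) (cong (λ m → interval (suc s) c ++ [ m ]) (sym (+-suc s c))))

range1≡interval : ∀ n → range1 n ≡ interval 1 n
range1≡interval zero    = refl
range1≡interval (suc n) = trans (cong (_++ [ suc n ]) (range1≡interval n)) (sym (interval-snoc 1 n))

interval-+ : ∀ s c₁ c₂ → interval s (c₁ + c₂) ≡ interval s c₁ ++ interval (s + c₁) c₂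
interval-+ s zero     c₂ = cong (λ m → interval m c₂) (sym (+-identityʳ s))
interval-+ s (suc c₁) c₂ =
  cong (s ∷_) (trans (interval-+ (suc s) c₁ c₂)
                     (cong (λ m → interval (suc s) c₁ ++ interval m c₂) (sym (+-suc s c₁))))

∈-interval : ∀ {v} s c → v ∈ interval s c → s ≤ v × v < s + c
∈-interval s (suc c) (here refl) = ≤-refl , m<m+n s (s≤s z≤n)
∈-interval {v} s (suc c) (there v∈) with ∈-interval (suc s) c v∈
... | s<v , v<s+c = <⇒≤ s<v , subst (v <_) (sym (+-suc s c)) v<s+c

∈-interval⁺ : ∀ {v} s c → s ≤ v → v < s + c → v ∈ interval s c
∈-interval⁺ s zero    s≤v v<s+0 = ⊥-elim (<⇒≱ v<s+0 (subst (_≤ _) (sym (+-identityʳ s)) s≤v))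
∈-interval⁺ {v} s (suc c) s≤v v<s+c with m≤n⇒m<n∨m≡n s≤v
... | inj₂ refl = here refl
... | inj₁ s<v  = there (∈-interval⁺ (suc s) c s<v (subst (v <_) (+-suc s c) v<s+c))

-- Largest and second largest entries

largest : List ℕ → ℕ
largest []      = 0
largest (x ∷ l) = x ⊔ largest l

-- Junk value 0 on lists with fewer than two entries, which lies below every entry of a permutation.
secondLargest : List ℕ → ℕ
secondLargest []      = 0
secondLargest (x ∷ l) = (x ⊓ largest l) ⊔ secondLargest l

≤-largest : ∀ {u l} → u ∈ l → u ≤ largest l
≤-largest {l = x ∷ l} (here refl) = m≤m⊔n x (largest l)
≤-largest {l = x ∷ l} (there u∈l) = ≤-trans (≤-largest u∈l) (m≤n⊔m x (largest l))

largest-∈ : ∀ x l → largest (x ∷ l) ∈ x ∷ l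
largest-∈ x []      = here (⊔-identityʳ x)
largest-∈ x (y ∷ l) with ⊔-sel x (largest (y ∷ l))
... | inj₁ eq = here eq
... | inj₂ eq = there (subst (_∈ y ∷ l) (sym eq) (largest-∈ y l))

secondLargest≤largest : ∀ l → secondLargest l ≤ largest l
secondLargest≤largest []      = z≤n
secondLargest≤largest (x ∷ l) =
  ⊔-lub (≤-trans (m⊓n≤m x (largest l)) (m≤m⊔n x (largest l)))
        (≤-trans (secondLargest≤largest l) (m≤n⊔m x (largest l)))

secondLargest-[_] : ∀ y → secondLargest (y ∷ []) ≡ 0
secondLargest-[ y ] = trans (⊔-identityʳ (y ⊓ 0)) (⊓-zeroʳ y)

secondLargest-∈ : ∀ x y l → secondLargest (x ∷ y ∷ l) ∈ x ∷ y ∷ l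
secondLargest-∈ x y [] rewrite secondLargest-[ y ] | ⊔-identityʳ y | ⊔-identityʳ (x ⊓ y)
  with ⊓-sel x y
... | inj₁ eq = here eq
... | inj₂ eq = there (here eq)
secondLargest-∈ x y (z ∷ l) with ⊔-sel (x ⊓ largest (y ∷ z ∷ l)) (secondLargest (y ∷ z ∷ l))
... | inj₂ eq = there (subst (_∈ y ∷ z ∷ l) (sym eq) (secondLargest-∈ y z l))
... | inj₁ eq with ⊓-sel x (largest (y ∷ z ∷ l))
...   | inj₁ eq′ = here (trans eq eq′)
...   | inj₂ eq′ = there (subst (_∈ y ∷ z ∷ l) (sym (trans eq eq′)) (largest-∈ y (z ∷ l)))

largest⊎≤secondLargest : ∀ {u l} → u ∈ l → u ≡ largest l ⊎ u ≤ secondLargest l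
largest⊎≤secondLargest {l = x ∷ l} (here refl) with ≤-total (largest l) x
... | inj₁ l≤x = inj₁ (sym (m≥n⇒m⊔n≡m l≤x))
... | inj₂ x≤l = inj₂ (≤-trans (≤-reflexive (sym (m≤n⇒m⊓n≡m x≤l))) (m≤m⊔n _ (secondLargest l)))
largest⊎≤secondLargest {l = x ∷ l} (there u∈l) with largest⊎≤secondLargest u∈l
... | inj₂ u≤s = inj₂ (≤-trans u≤s (m≤n⊔m (x ⊓ largest l) (secondLargest l)))
... | inj₁ refl with ≤-total x (largest l)
...   | inj₁ x≤l = inj₁ (sym (m≤n⇒m⊔n≡n x≤l))
...   | inj₂ l≤x = inj₂ (≤-trans (≤-reflexive (sym (m≥n⇒m⊓n≡n l≤x))) (m≤m⊔n _ (secondLargest l)))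

largest-++ : ∀ P W → largest W ≤ largest (P ++ W)
largest-++ []      W = ≤-refl
largest-++ (x ∷ P) W = ≤-trans (largest-++ P W) (m≤n⊔m x (largest (P ++ W)))

secondLargest-++ : ∀ P W → secondLargest W ≤ secondLargest (P ++ W)
secondLargest-++ []      W = ≤-refl
secondLargest-++ (x ∷ P) W =
  ≤-trans (secondLargest-++ P W) (m≤n⊔m (x ⊓ largest (P ++ W)) (secondLargest (P ++ W)))

secondLargest<largest : ∀ x y l → Unique (x ∷ y ∷ l) → secondLargest (x ∷ y ∷ l) < largest (x ∷ y ∷ l)
secondLargest<largest x y l u@(x∉ ∷ _) with <-cmp x (largest (y ∷ l))
... | tri≈ _ x≡M _ = ⊥-elim (All¬⇒¬Any x∉ (subst (_∈ y ∷ l) (sym x≡M) (largest-∈ y l)))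
... | tri< x<M _ _ = ⊔-lub (<-≤-trans (≤-<-trans (m⊓n≤m x _) x<M) (m≤n⊔m x _))
                           (<-≤-trans (tail<M l u x<M) (m≤n⊔m x _))
  where
    tail<M : ∀ l → Unique (x ∷ y ∷ l) → x < largest (y ∷ l) → secondLargest (y ∷ l) < largest (y ∷ l)
    tail<M []      _       x<y rewrite secondLargest-[ y ] = ≤-<-trans z≤n x<y
    tail<M (z ∷ l) (_ ∷ u) _   = secondLargest<largest y z l u
... | tri> _ _ M<x = ⊔-lub (<-≤-trans (≤-<-trans (m⊓n≤n x _) M<x) (m≤m⊔n x _))
                           (<-≤-trans (≤-<-trans (secondLargest≤largest (y ∷ l)) M<x) (m≤m⊔n x _))

secondLargest<largest-∷ : ∀ x l → Unique (x ∷ l) → 0 < x → secondLargest (x ∷ l) < largest (x ∷ l)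
secondLargest<largest-∷ x []      _ 0<x rewrite secondLargest-[ x ] | ⊔-identityʳ x = 0<x
secondLargest<largest-∷ x (y ∷ l) u _   = secondLargest<largest x y l u

largest-↭ : ∀ {xs ys} → xs ↭ ys → largest xs ≡ largest ys
largest-↭ ↭.refl        = refl
largest-↭ (prep x p)    = cong (x ⊔_) (largest-↭ p)
largest-↭ (swap {xs} {ys} x y p) = begin
  x ⊔ (y ⊔ largest xs) ≡⟨ sym (⊔-assoc x y _) ⟩
  (x ⊔ y) ⊔ largest xs ≡⟨ cong₂ _⊔_ (⊔-comm x y) (largest-↭ p) ⟩
  (y ⊔ x) ⊔ largest ys ≡⟨ ⊔-assoc y x _ ⟩
  y ⊔ (x ⊔ largest ys) ∎
  where open ≡-Reasoning
largest-↭ (↭.trans p q) = trans (largest-↭ p) (largest-↭ q)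

private
  ⊓⊔-swap : ∀ x y m → (x ⊓ (y ⊔ m)) ⊔ (y ⊓ m) ≡ (y ⊓ (x ⊔ m)) ⊔ (x ⊓ m)
  ⊓⊔-swap x y m = begin
    (x ⊓ (y ⊔ m)) ⊔ (y ⊓ m)       ≡⟨ cong (_⊔ (y ⊓ m)) (⊓-distribˡ-⊔ x y m) ⟩
    ((x ⊓ y) ⊔ (x ⊓ m)) ⊔ (y ⊓ m) ≡⟨ ⊔-assoc (x ⊓ y) (x ⊓ m) (y ⊓ m) ⟩
    (x ⊓ y) ⊔ ((x ⊓ m) ⊔ (y ⊓ m)) ≡⟨ cong₂ _⊔_ (⊓-comm x y) (⊔-comm (x ⊓ m) (y ⊓ m)) ⟩
    (y ⊓ x) ⊔ ((y ⊓ m) ⊔ (x ⊓ m)) ≡⟨ sym (⊔-assoc (y ⊓ x) (y ⊓ m) (x ⊓ m)) ⟩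
    ((y ⊓ x) ⊔ (y ⊓ m)) ⊔ (x ⊓ m) ≡⟨ cong (_⊔ (x ⊓ m)) (sym (⊓-distribˡ-⊔ y x m)) ⟩
    (y ⊓ (x ⊔ m)) ⊔ (x ⊓ m)       ∎
    where open ≡-Reasoning

secondLargest-↭ : ∀ {xs ys} → xs ↭ ys → secondLargest xs ≡ secondLargest ys
secondLargest-↭ ↭.refl     = refl
secondLargest-↭ (prep x p) = cong₂ (λ m s → (x ⊓ m) ⊔ s) (largest-↭ p) (secondLargest-↭ p)
secondLargest-↭ (swap {xs} {ys} x y p) = begin
  (x ⊓ (y ⊔ m)) ⊔ ((y ⊓ m) ⊔ s)  ≡⟨ sym (⊔-assoc (x ⊓ (y ⊔ m)) (y ⊓ m) s) ⟩
  ((x ⊓ (y ⊔ m)) ⊔ (y ⊓ m)) ⊔ s  ≡⟨ cong₂ _⊔_ (⊓⊔-swap x y m) (secondLargest-↭ p) ⟩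
  ((y ⊓ (x ⊔ m)) ⊔ (x ⊓ m)) ⊔ s′ ≡⟨ ⊔-assoc (y ⊓ (x ⊔ m)) (x ⊓ m) s′ ⟩
  (y ⊓ (x ⊔ m)) ⊔ ((x ⊓ m) ⊔ s′) ≡⟨ cong (λ m → (y ⊓ (x ⊔ m)) ⊔ ((x ⊓ m) ⊔ s′)) (largest-↭ p) ⟩
  (y ⊓ (x ⊔ largest ys)) ⊔ ((x ⊓ largest ys) ⊔ s′) ∎
  where
    open ≡-Reasoning
    m  = largest xs
    s  = secondLargest xs
    s′ = secondLargest ys
secondLargest-↭ (↭.trans p q) = trans (secondLargest-↭ p) (secondLargest-↭ q)

secondLargest-∷-above : ∀ b S → largest S < b → secondLargest (b ∷ S) ≡ largest S
secondLargest-∷-above b S M<b rewrite m≥n⇒m⊓n≡n (<⇒≤ M<b) = m≥n⇒m⊔n≡m (secondLargest≤largest S)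

secondLargest-∷-between : ∀ b S → secondLargest S < b → b < largest S → secondLargest (b ∷ S) ≡ b
secondLargest-∷-between b S s<b b<M rewrite m≤n⇒m⊓n≡m (<⇒≤ b<M) = m≥n⇒m⊔n≡m (<⇒≤ s<b)

secondLargest-∷-below : ∀ b S → b < secondLargest S → secondLargest (b ∷ S) ≡ secondLargest S
secondLargest-∷-below b S b<s rewrite m≤n⇒m⊓n≡m (<⇒≤ (<-≤-trans b<s (secondLargest≤largest S))) =
  m≤n⇒m⊔n≡n (<⇒≤ b<s)

secondLargest≢ : ∀ {b} S → 0 < b → b ∉ S → secondLargest S ≢ b
secondLargest≢ []          0<b _  s≡b = <-irrefl s≡b 0<b
secondLargest≢ (y ∷ [])    0<b _  s≡b = <-irrefl (trans (sym (secondLargest-[ y ])) s≡b) 0<b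
secondLargest≢ (y ∷ z ∷ S) _   b∉ s≡b = b∉ (subst (_∈ y ∷ z ∷ S) s≡b (secondLargest-∈ y z S))

count-above-largest : ∀ b S → largest S < b → count (b <ᵇ_) S ≡ 0
count-above-largest b []      _   = refl
count-above-largest b (x ∷ S) M<b rewrite <ᵇ-false {b} {x} (<⇒≤ (m⊔n<o⇒m<o x _ M<b)) =
  count-above-largest b S (m⊔n<o⇒n<o x _ M<b)

count-above-∈ : ∀ b {v} S → v ∈ S → b < v → 1 ≤ count (b <ᵇ_) S
count-above-∈ b (x ∷ S) (here refl) b<v rewrite <ᵇ-true b<v = s≤s z≤n
count-above-∈ b (x ∷ S) (there v∈S) b<v = ≤-trans (count-above-∈ b S v∈S b<v) (m≤n+m _ (indicator (b <ᵇ x)))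

count-above-second≤1 : ∀ b S → secondLargest S < b → count (b <ᵇ_) S ≤ 1
count-above-second≤1 b []      _   = z≤n
count-above-second≤1 b (x ∷ S) s<b with b <? x
... | no b≮x rewrite <ᵇ-false (≮⇒≥ b≮x) = count-above-second≤1 b S (m⊔n<o⇒n<o _ _ s<b)
... | yes b<x rewrite <ᵇ-true b<x = ≤-reflexive (cong suc (count-above-largest b S M<b))
  where
    x⊓M<b : x ⊓ largest S < b
    x⊓M<b = m⊔n<o⇒m<o _ _ s<b
    M<b : largest S < b
    M<b with ⊓-sel x (largest S)
    ... | inj₁ x⊓M≡x = ⊥-elim (<-asym b<x (subst (_< b) x⊓M≡x x⊓M<b))
    ... | inj₂ x⊓M≡M = subst (_< b) x⊓M≡M x⊓M<b

count-above-second : ∀ b S → secondLargest S < b → b < largest S → count (b <ᵇ_) S ≡ 1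
count-above-second b (x ∷ S) s<b b<M =
  ≤-antisym (count-above-second≤1 b (x ∷ S) s<b) (count-above-∈ b (x ∷ S) (largest-∈ x S) b<M)

count-above-below : ∀ b S → b < secondLargest S → 2 ≤ count (b <ᵇ_) S
count-above-below b (x ∷ S) b<s with ⊔-sel (x ⊓ largest S) (secondLargest S)
... | inj₂ eq = ≤-trans (count-above-below b S (subst (b <_) eq b<s)) (m≤n+m _ (indicator (b <ᵇ x)))
... | inj₁ eq = subst (λ c → 2 ≤ indicator c + count (b <ᵇ_) S) (sym (<ᵇ-true b<x))
                     (s≤s (count-above-∈ b S (largest-∈′ S b<M) b<M))
  where
    b<x⊓M : b < x ⊓ largest S
    b<x⊓M = subst (b <_) eq b<s
    b<x = <-≤-trans b<x⊓M (m⊓n≤m x (largest S))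
    b<M = <-≤-trans b<x⊓M (m⊓n≤n x (largest S))
    largest-∈′ : ∀ S → b < largest S → largest S ∈ S
    largest-∈′ (y ∷ S) _ = largest-∈ y S

-- The involution Φ

replace : ℕ → ℕ → ℕ → ℕ
replace M x v = if v ≡ᵇ M then x else v

replace-self : ∀ M x → replace M x M ≡ x
replace-self M x rewrite ≡ᵇ-true {M} refl = refl

replace-other : ∀ {M x v} → v ≢ M → replace M x v ≡ v
replace-other v≢M rewrite ≡ᵇ-false v≢M = refl

map-replace-∉ : ∀ {M x} l → M ∉ l → map (replace M x) l ≡ l
map-replace-∉ []      _   = refl
map-replace-∉ (v ∷ l) M∉ =
  cong₂ _∷_ (replace-other (λ v≡M → M∉ (here (sym v≡M)))) (map-replace-∉ l (M∉ ∘ there))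

map-replace-∈ : ∀ {M x} V → M ∈ V → x ∈ map (replace M x) V
map-replace-∈ {M} {x} (v ∷ V) (here refl) = here (sym (replace-self v x))
map-replace-∈         (v ∷ V) (there M∈V) = there (map-replace-∈ V M∈V)

map-replace-involutive : ∀ M x l → x ∉ l → map (replace x M) (map (replace M x) l) ≡ l
map-replace-involutive M x []      _  = refl
map-replace-involutive M x (v ∷ l) x∉ = cong₂ _∷_ head (map-replace-involutive M x l (x∉ ∘ there))
  where
    head : replace x M (replace M x v) ≡ v
    head with v ≟ M
    ... | yes refl = trans (cong (replace x v) (replace-self v x)) (replace-self x v)
    ... | no v≢M   = trans (cong (replace x M) (replace-other v≢M))
                           (replace-other (λ v≡x → x∉ (here (sym v≡x))))

map-replace-middle : ∀ {M} x pre post → M ∉ pre ++ post → map (replace M x) (pre ++ M ∷ post) ≡ pre ++ x ∷ post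
map-replace-middle {M} x pre post M∉ = begin
  map g (pre ++ M ∷ post)       ≡⟨ map-++ g pre (M ∷ post) ⟩
  map g pre ++ g M ∷ map g post ≡⟨ cong (λ y → map g pre ++ y ∷ map g post) (replace-self M x) ⟩
  map g pre ++ x ∷ map g post   ≡⟨ cong₂ (λ P Q → P ++ x ∷ Q) (map-replace-∉ pre (M∉ ∘ ∈-++⁺ˡ))
                                                               (map-replace-∉ post (M∉ ∘ ∈-++⁺ʳ pre)) ⟩
  pre ++ x ∷ post               ∎
  where
    open ≡-Reasoning
    g = replace M x

all-map-replace : ∀ a M x V → a < x → a < M → all (a <ᵇ_) (map (replace M x) V) ≡ all (a <ᵇ_) V
all-map-replace a M x []      _   _   = refl
all-map-replace a M x (v ∷ V) a<x a<M with v ≟ M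
... | yes refl rewrite replace-self v x | <ᵇ-true a<x | <ᵇ-true a<M = all-map-replace a v x V a<x a<M
... | no v≢M   rewrite replace-other {M} {x} v≢M = cong ((a <ᵇ v) ∧_) (all-map-replace a M x V a<x a<M)

Φ-step : ℕ → List ℕ → List ℕ → List ℕ
Φ-step x L V =
  if secondLargest L <ᵇ x then largest L ∷ map (replace (largest L) x) V else x ∷ V

Φ : List ℕ → List ℕ
Φ []          = []
Φ (x ∷ [])    = x ∷ []
Φ (x ∷ y ∷ l) = Φ-step x (y ∷ l) (Φ (y ∷ l))

Φ-step-above : ∀ x L V → secondLargest L < x → Φ-step x L V ≡ largest L ∷ map (replace (largest L) x) V
Φ-step-above x L V s<x rewrite <ᵇ-true s<x = refl

Φ-step-below : ∀ x L V → x ≤ secondLargest L → Φ-step x L V ≡ x ∷ V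
Φ-step-below x L V x≤s rewrite <ᵇ-false {secondLargest L} x≤s = refl

Φ-∷-shape : ∀ b S → ∃ λ h → ∃ λ V → Φ (b ∷ S) ≡ h ∷ V
Φ-∷-shape b []      = b , [] , refl
Φ-∷-shape b (y ∷ S) with secondLargest (y ∷ S) <ᵇ b
... | true  = _ , _ , refl
... | false = _ , _ , refl

Φ-step-↭ : ∀ x y l {V} → Unique (x ∷ y ∷ l) → V ↭ y ∷ l → Φ-step x (y ∷ l) V ↭ x ∷ y ∷ l
Φ-step-↭ x y l {V} (_ ∷ u) V↭L with secondLargest (y ∷ l) <ᵇ x
... | false = prep x V↭L
... | true with ∈-∃++ (largest-∈ y l)
...   | pre , post , L≡ = begin
  M ∷ map g V                 ↭⟨ prep M (↭.map⁺ g V↭L) ⟩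
  M ∷ map g (y ∷ l)           ≡⟨ cong (λ L → M ∷ map g L) L≡ ⟩
  M ∷ map g (pre ++ M ∷ post) ≡⟨ cong (M ∷_) (map-replace-middle x pre post (∉-middle pre post (subst Unique L≡ u))) ⟩
  M ∷ pre ++ x ∷ post         ↭⟨ prep M (shift x pre post) ⟩
  M ∷ x ∷ pre ++ post         ↭⟨ swap M x ↭-refl ⟩
  x ∷ M ∷ pre ++ post         ↭⟨ prep x (↭-sym (shift M pre post)) ⟩
  x ∷ pre ++ M ∷ post         ≡⟨ cong (x ∷_) (sym L≡) ⟩
  x ∷ y ∷ l                   ∎
  where
    open ↭.PermutationReasoning
    M = largest (y ∷ l)
    g = replace M x

Φ-↭ : ∀ l → Unique l → Φ l ↭ l
Φ-↭ []          _       = ↭-refl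
Φ-↭ (x ∷ [])    _       = ↭-refl
Φ-↭ (x ∷ y ∷ l) u@(_ ∷ u′) = Φ-step-↭ x y l u (Φ-↭ (y ∷ l) u′)

Positive : List ℕ → Set
Positive l = ∀ {u} → u ∈ l → 0 < u

StrictMonoOn : (ℕ → ℕ) → List ℕ → Set
StrictMonoOn g l = ∀ {u v} → u ∈ l → v ∈ l → u < v → g u < g v

module _ {g : ℕ → ℕ} {l : List ℕ} (mono : StrictMonoOn g l) where

  restrict : ∀ {l′} → (∀ {w} → w ∈ l′ → w ∈ l) → StrictMonoOn g l′
  restrict ⊆ u∈ v∈ = mono (⊆ u∈) (⊆ v∈)

  injectiveOn : ∀ {u v} → u ∈ l → v ∈ l → g u ≡ g v → u ≡ v
  injectiveOn {u} {v} u∈ v∈ gu≡gv with <-cmp u v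
  ... | tri< u<v _ _ = ⊥-elim (<-irrefl gu≡gv (mono u∈ v∈ u<v))
  ... | tri≈ _ u≡v _ = u≡v
  ... | tri> _ _ v<u = ⊥-elim (<-irrefl (sym gu≡gv) (mono v∈ u∈ v<u))

  <ᵇ-preserved : ∀ {u v} → u ∈ l → v ∈ l → (g u <ᵇ g v) ≡ (u <ᵇ v)
  <ᵇ-preserved {u} {v} u∈ v∈ with <-cmp u v
  ... | tri< u<v _ _    = trans (<ᵇ-true (mono u∈ v∈ u<v)) (sym (<ᵇ-true u<v))
  ... | tri≈ _ refl _   = trans (<ᵇ-false {g u} ≤-refl) (sym (<ᵇ-false {u} ≤-refl))
  ... | tri> _ _ v<u    = trans (<ᵇ-false (<⇒≤ (mono v∈ u∈ v<u))) (sym (<ᵇ-false (<⇒≤ v<u)))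

  ≤-preserved : ∀ {u v} → u ∈ l → v ∈ l → u ≤ v → g u ≤ g v
  ≤-preserved u∈ v∈ u≤v with m≤n⇒m<n∨m≡n u≤v
  ... | inj₁ u<v  = <⇒≤ (mono u∈ v∈ u<v)
  ... | inj₂ refl = ≤-refl

  ⊔-preserved : ∀ {u v} → u ∈ l → v ∈ l → g u ⊔ g v ≡ g (u ⊔ v)
  ⊔-preserved {u} {v} u∈ v∈ with ≤-total u v
  ... | inj₁ u≤v = trans (m≤n⇒m⊔n≡n (≤-preserved u∈ v∈ u≤v)) (cong g (sym (m≤n⇒m⊔n≡n u≤v)))
  ... | inj₂ v≤u = trans (m≥n⇒m⊔n≡m (≤-preserved v∈ u∈ v≤u)) (cong g (sym (m≥n⇒m⊔n≡m v≤u)))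

  ⊓-preserved : ∀ {u v} → u ∈ l → v ∈ l → g u ⊓ g v ≡ g (u ⊓ v)
  ⊓-preserved {u} {v} u∈ v∈ with ≤-total u v
  ... | inj₁ u≤v = trans (m≤n⇒m⊓n≡m (≤-preserved u∈ v∈ u≤v)) (cong g (sym (m≤n⇒m⊓n≡m u≤v)))
  ... | inj₂ v≤u = trans (m≥n⇒m⊓n≡n (≤-preserved v∈ u∈ v≤u)) (cong g (sym (m≥n⇒m⊓n≡n v≤u)))

  replace-preserved : ∀ {M x v} → v ∈ l → M ∈ l → replace (g M) (g x) (g v) ≡ g (replace M x v)
  replace-preserved {M} {x} {v} v∈ M∈ with v ≟ M
  ... | yes refl = trans (replace-self (g v) (g x)) (cong g (sym (replace-self v x)))
  ... | no v≢M   = trans (replace-other (v≢M ∘ injectiveOn v∈ M∈)) (cong g (sym (replace-other v≢M)))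

  map-replace-preserved : ∀ {M x} V → (∀ {w} → w ∈ V → w ∈ l) → M ∈ l →
                          map (replace (g M) (g x)) (map g V) ≡ map g (map (replace M x) V)
  map-replace-preserved []      _ _  = refl
  map-replace-preserved (v ∷ V) ⊆ M∈ =
    cong₂ _∷_ (replace-preserved (⊆ (here refl)) M∈) (map-replace-preserved V (⊆ ∘ there) M∈)

largest-map : ∀ {g} x l → StrictMonoOn g (x ∷ l) → largest (map g (x ∷ l)) ≡ g (largest (x ∷ l))
largest-map {g} x []      mono = trans (⊔-identityʳ (g x)) (cong g (sym (⊔-identityʳ x)))
largest-map {g} x (y ∷ l) mono = trans (cong (g x ⊔_) (largest-map y l (restrict mono there)))
                                       (⊔-preserved mono (here refl) (there (largest-∈ y l)))

secondLargest-map : ∀ {g} x y l → StrictMonoOn g (x ∷ y ∷ l) →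
                    secondLargest (map g (x ∷ y ∷ l)) ≡ g (secondLargest (x ∷ y ∷ l))
secondLargest-map {g} x y [] mono
  rewrite secondLargest-[ y ] | secondLargest-[ g y ] | ⊔-identityʳ y | ⊔-identityʳ (g y)
        | ⊔-identityʳ (g x ⊓ g y) | ⊔-identityʳ (x ⊓ y) = ⊓-preserved mono (here refl) (there (here refl))
secondLargest-map {g} x y (z ∷ l) mono = begin
  (g x ⊓ largest (map g L)) ⊔ secondLargest (map g L)
    ≡⟨ cong₂ (λ m s → (g x ⊓ m) ⊔ s) (largest-map y (z ∷ l) (restrict mono there))
                                      (secondLargest-map y z l (restrict mono there)) ⟩
  (g x ⊓ g M) ⊔ g s ≡⟨ cong (_⊔ g s) (⊓-preserved mono (here refl) M∈) ⟩
  g (x ⊓ M) ⊔ g s   ≡⟨ ⊔-preserved mono x⊓M∈ s∈ ⟩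
  g ((x ⊓ M) ⊔ s)   ∎
  where
    open ≡-Reasoning
    L = y ∷ z ∷ l
    M = largest L
    s = secondLargest L
    M∈ : M ∈ x ∷ L
    M∈ = there (largest-∈ y (z ∷ l))
    s∈ : s ∈ x ∷ L
    s∈ = there (secondLargest-∈ y z l)
    x⊓M∈ : x ⊓ M ∈ x ∷ L
    x⊓M∈ with ⊓-sel x M
    ... | inj₁ eq = here eq
    ... | inj₂ eq = subst (_∈ x ∷ L) (sym eq) M∈

Φ-test-map : ∀ {g} x y l → StrictMonoOn g (x ∷ y ∷ l) → 0 < x → 0 < g x →
             (secondLargest (map g (y ∷ l)) <ᵇ g x) ≡ (secondLargest (y ∷ l) <ᵇ x)
Φ-test-map {g} x y []      _    0<x 0<gx rewrite secondLargest-[ y ] | secondLargest-[ g y ] =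
  trans (<ᵇ-true 0<gx) (sym (<ᵇ-true 0<x))
Φ-test-map {g} x y (z ∷ l) mono _   _    rewrite secondLargest-map y z l (restrict mono there) =
  <ᵇ-preserved mono (there (secondLargest-∈ y z l)) (here refl)

Φ-step-map : ∀ {g} x y l {V} → StrictMonoOn g (x ∷ y ∷ l) → (∀ {w} → w ∈ V → w ∈ y ∷ l) →
             0 < x → 0 < g x → Φ-step (g x) (map g (y ∷ l)) (map g V) ≡ map g (Φ-step x (y ∷ l) V)
Φ-step-map {g} x y l {V} mono V⊆ 0<x 0<gx rewrite Φ-test-map x y l mono 0<x 0<gx
  with secondLargest (y ∷ l) <ᵇ x
... | false = refl
... | true  = cong₂ _∷_ largest≡ (trans (cong (λ m → map (replace m (g x)) (map g V)) largest≡)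
                                       (map-replace-preserved mono V (there ∘ V⊆) (there (largest-∈ y l))))
  where
    largest≡ : largest (map g (y ∷ l)) ≡ g (largest (y ∷ l))
    largest≡ = largest-map y l (restrict mono there)

Φ-map : ∀ {g} l → Unique l → StrictMonoOn g l → Positive l → (∀ {u} → u ∈ l → 0 < g u) →
        Φ (map g l) ≡ map g (Φ l)
Φ-map []          _          _    _   _    = refl
Φ-map (x ∷ [])    _          _    _   _    = refl
Φ-map {g} (x ∷ y ∷ l) (_ ∷ u) mono pos gpos =
  trans (cong (Φ-step (g x) (map g (y ∷ l)))
              (Φ-map (y ∷ l) u (restrict mono there) (pos ∘ there) (gpos ∘ there)))
        (Φ-step-map x y l mono (∈-resp-↭ (Φ-↭ (y ∷ l) u)) (pos (here refl)) (gpos (here refl)))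

Φ-∷ : ∀ x {L y l} → L ↭ y ∷ l → Φ (x ∷ L) ≡ Φ-step x L (Φ L)
Φ-∷ x {[]}    L↭ with () ← ↭-length L↭
Φ-∷ x {_ ∷ _} _  = refl

replace-largest-mono : ∀ L {x} → secondLargest L < x → StrictMonoOn (replace (largest L) x) L
replace-largest-mono L {x} s<x {u} {v} u∈ v∈ u<v with v ≟ largest L
... | yes refl = begin-strict
  replace (largest L) x u ≡⟨ replace-other u≢M ⟩
  u                       ≤⟨ u≤s ⟩
  secondLargest L         <⟨ s<x ⟩
  x                       ≡⟨ replace-self (largest L) x ⟨
  replace (largest L) x v ∎
  where
    open ≤-Reasoning
    u≢M : u ≢ largest L
    u≢M u≡M = <-irrefl u≡M u<v
    u≤s : u ≤ secondLargest L
    u≤s with largest⊎≤secondLargest u∈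
    ... | inj₁ u≡M = ⊥-elim (u≢M u≡M)
    ... | inj₂ u≤s = u≤s
... | no v≢M with u ≟ largest L
...   | yes refl = ⊥-elim (<⇒≱ u<v (≤-largest v∈))
...   | no u≢M rewrite replace-other {largest L} {x} u≢M | replace-other {largest L} {x} v≢M = u<v

replace-positive : ∀ M {x u} → 0 < x → 0 < u → 0 < replace M x u
replace-positive M {x} {u} 0<x 0<u with u ≟ M
... | yes refl = subst (0 <_) (sym (replace-self u x)) 0<x
... | no u≢M   = subst (0 <_) (sym (replace-other u≢M)) 0<u

secondLargest-replace-largest : ∀ y l {x} → Unique (y ∷ l) → secondLargest (y ∷ l) < x →
  secondLargest (map (replace (largest (y ∷ l)) x) (y ∷ l)) ≡ secondLargest (y ∷ l)
secondLargest-replace-largest y []      _ _   rewrite secondLargest-[ y ] = secondLargest-[ _ ]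
secondLargest-replace-largest y (z ∷ l) u s<x =
  trans (secondLargest-map y z l (replace-largest-mono (y ∷ z ∷ l) s<x))
        (replace-other (<⇒≢ (secondLargest<largest y z l u)))

largest-replace-largest : ∀ y S {b} → secondLargest (y ∷ S) < b →
  largest (map (replace (largest (y ∷ S)) b) (y ∷ S)) ≡ b
largest-replace-largest y S {b} s<b =
  trans (largest-map y S (replace-largest-mono (y ∷ S) s<b)) (replace-self (largest (y ∷ S)) b)

Φ-involutive-kept : ∀ x y l → Unique (y ∷ l) → x ≤ secondLargest (y ∷ l) →
  Φ (Φ (y ∷ l)) ≡ y ∷ l → Φ (Φ (x ∷ y ∷ l)) ≡ x ∷ y ∷ l
Φ-involutive-kept x y l uL x≤s ih = begin
  Φ (Φ (x ∷ L))            ≡⟨ cong Φ (Φ-step-below x L (Φ L) x≤s) ⟩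
  Φ (x ∷ Φ L)              ≡⟨ Φ-∷ x ΦL↭L ⟩
  Φ-step x (Φ L) (Φ (Φ L)) ≡⟨ cong (Φ-step x (Φ L)) ih ⟩
  Φ-step x (Φ L) L         ≡⟨ Φ-step-below x (Φ L) L (subst (x ≤_) (sym (secondLargest-↭ ΦL↭L)) x≤s) ⟩
  x ∷ L                    ∎
  where
    open ≡-Reasoning
    L = y ∷ l
    ΦL↭L = Φ-↭ L uL

-- Φ exchanged x with M = largest L. The relabelling g of L that sends M to x is strictly
-- monotone, so it commutes with Φ, and the second pass exchanges x and M back.
Φ-involutive-exchanged : ∀ x y l → Unique (x ∷ y ∷ l) → Positive (x ∷ y ∷ l) → secondLargest (y ∷ l) < x →
  Φ (Φ (y ∷ l)) ≡ y ∷ l → Φ (Φ (x ∷ y ∷ l)) ≡ x ∷ y ∷ l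
Φ-involutive-exchanged x y l (x∉ ∷ uL) pos s<x ih = begin
  Φ (Φ (x ∷ L))                   ≡⟨ cong Φ (Φ-step-above x L (Φ L) s<x) ⟩
  Φ (M ∷ K)                       ≡⟨ Φ-∷ M K↭gL ⟩
  Φ-step M K (Φ K)                ≡⟨ cong (Φ-step M K) ΦK≡gL ⟩
  Φ-step M K (map g L)            ≡⟨ Φ-step-above M K (map g L) sK<M ⟩
  largest K ∷ map (replace (largest K) M) (map g L)
                                  ≡⟨ cong (λ m → m ∷ map (replace m M) (map g L)) largestK≡x ⟩
  x ∷ map (replace x M) (map g L) ≡⟨ cong (x ∷_) (map-replace-involutive M x L (All¬⇒¬Any x∉)) ⟩
  x ∷ L                           ∎
  where
    open ≡-Reasoning
    L = y ∷ l
    M = largest L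
    g = replace M x
    K = map g (Φ L)
    ΦL↭L = Φ-↭ L uL
    K↭gL : K ↭ map g L
    K↭gL = ↭.map⁺ g ΦL↭L
    mono : StrictMonoOn g L
    mono = replace-largest-mono L s<x
    ΦK≡gL : Φ K ≡ map g L
    ΦK≡gL = trans (Φ-map (Φ L) (Unique-resp-↭ (↭-sym ΦL↭L) uL) (restrict mono (∈-resp-↭ ΦL↭L))
                         (pos ∘ there ∘ ∈-resp-↭ ΦL↭L)
                         (replace-positive M (pos (here refl)) ∘ pos ∘ there ∘ ∈-resp-↭ ΦL↭L))
                  (cong (map g) ih)
    sK<M : secondLargest K < M
    sK<M = subst (_< M) (sym (trans (secondLargest-↭ K↭gL) (secondLargest-replace-largest y l uL s<x)))
                 (secondLargest<largest-∷ y l uL (pos (there (here refl))))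
    largestK≡x : largest K ≡ x
    largestK≡x = trans (largest-↭ K↭gL) (trans (largest-map y l mono) (replace-self M x))

Φ-involutive : ∀ l → Unique l → Positive l → Φ (Φ l) ≡ l
Φ-involutive []          _          _   = refl
Φ-involutive (x ∷ [])    _          _   = refl
Φ-involutive (x ∷ y ∷ l) u@(_ ∷ uL) pos with x ≤? secondLargest (y ∷ l)
... | yes x≤s = Φ-involutive-kept x y l uL x≤s (Φ-involutive (y ∷ l) uL (pos ∘ there))
... | no x≰s  = Φ-involutive-exchanged x y l u pos (≰⇒> x≰s) (Φ-involutive (y ∷ l) uL (pos ∘ there))

-- Agreement up to a threshold

AgreeUpTo : ℕ → ℕ → ℕ → Set
AgreeUpTo t u u′ = (u ≤ t → u′ ≡ u) × (t < u → t < u′)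

AgreeUpTo-refl : ∀ t u → AgreeUpTo t u u
AgreeUpTo-refl t u = (λ _ → refl) , id

map-replace-agree : ∀ {t M x U V} → t < M → t < x → Pointwise (AgreeUpTo t) U V →
                    Pointwise (AgreeUpTo t) U (map (replace M x) V)
map-replace-agree t<M t<x [] = []
map-replace-agree {t} {M} {x} {u ∷ U} {v ∷ V} t<M t<x ((≤t⇒≡ , >t⇒>) ∷ U≈V) =
  head ∷ map-replace-agree t<M t<x U≈V
  where
    head : AgreeUpTo t u (replace M x v)
    head with v ≟ M
    ... | yes refl = (λ u≤t → ⊥-elim (<⇒≱ t<M (subst (_≤ t) (sym (≤t⇒≡ u≤t)) u≤t)))
                   , (λ _ → subst (t <_) (sym (replace-self v x)) t<x)
    ... | no v≢M rewrite replace-other {M} {x} v≢M = ≤t⇒≡ , >t⇒>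

Φ-step-agree : ∀ {t} x L {U V} → Pointwise (AgreeUpTo t) U V → (secondLargest L < x → t < x × t < largest L) →
               Pointwise (AgreeUpTo t) (x ∷ U) (Φ-step x L V)
Φ-step-agree {t} x L U≈V above with secondLargest L <? x
... | no x≤s = subst (Pointwise (AgreeUpTo t) (x ∷ _)) (sym (Φ-step-below x L _ (≮⇒≥ x≤s)))
                     (AgreeUpTo-refl t x ∷ U≈V)
... | yes s<x = subst (Pointwise (AgreeUpTo t) (x ∷ _)) (sym (Φ-step-above x L _ s<x))
                      (((λ x≤t → ⊥-elim (<⇒≱ t<x x≤t)) , λ _ → t<M) ∷ map-replace-agree t<M t<x U≈V)
  where
    t<x = proj₁ (above s<x)
    t<M = proj₂ (above s<x)

Φ-∷-++ : ∀ x P b S → Φ (x ∷ P ++ b ∷ S) ≡ Φ-step x (P ++ b ∷ S) (Φ (P ++ b ∷ S))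
Φ-∷-++ x []      b S = refl
Φ-∷-++ x (_ ∷ _) b S = refl

Φ-++ : ∀ P b S → Unique (P ++ b ∷ S) → Positive (P ++ b ∷ S) →
       Pointwise (AgreeUpTo (secondLargest (b ∷ S))) (P ++ Φ (b ∷ S)) (Φ (P ++ b ∷ S))
Φ-++ []      b S _       _   = Pointwise.refl (AgreeUpTo-refl _ _)
Φ-++ (x ∷ P) b S (_ ∷ u) pos rewrite Φ-∷-++ x P b S =
  Φ-step-agree x (P ++ W) (Φ-++ P b S u (pos ∘ there)) above
  where
    W = b ∷ S
    t<largestW : secondLargest W < largest W
    t<largestW = secondLargest<largest-∷ b S (Unique-++⁻ʳ P u) (pos (there (∈-++⁺ʳ P (here refl))))
    above : secondLargest (P ++ W) < x → secondLargest W < x × secondLargest W < largest (P ++ W)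
    above s<x = ≤-<-trans (secondLargest-++ P W) s<x , <-≤-trans t<largestW (largest-++ P W)

agree-≡ : ∀ {t U V} → Pointwise (AgreeUpTo t) U V → All (_≤ t) U → V ≡ U
agree-≡ []                []          = refl
agree-≡ ((≤t⇒≡ , _) ∷ U≈V) (u≤t ∷ U≤t) = cong₂ _∷_ (≤t⇒≡ u≤t) (agree-≡ U≈V U≤t)

-- The suffix of Φ π at the position of a suffix b ∷ S of π, seen up to the threshold: its head b′
-- is its largest entry exactly when b is the second largest entry of b ∷ S.
Φ-largest-head : ∀ b y S {b′ S′} → Unique (y ∷ S) → largest (y ∷ S) < b →
  Pointwise (AgreeUpTo (secondLargest (b ∷ y ∷ S))) (Φ (b ∷ y ∷ S)) (b′ ∷ S′) → b′ < largest S′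
Φ-largest-head b y S {b′} {S′} u M<b ΦW≈ = partner-above (Pointwise-∈ (Pointwise.tail agree) b∈)
  where
    L = y ∷ S
    M = largest L
    agree : Pointwise (AgreeUpTo M) (M ∷ map (replace M b) (Φ L)) (b′ ∷ S′)
    agree = subst₂ (λ t W → Pointwise (AgreeUpTo t) W (b′ ∷ S′)) (secondLargest-∷-above b L M<b)
                   (Φ-step-above b L (Φ L) (≤-<-trans (secondLargest≤largest L) M<b)) ΦW≈
    b∈ : b ∈ map (replace M b) (Φ L)
    b∈ = map-replace-∈ (Φ L) (∈-resp-↭ (↭-sym (Φ-↭ L u)) (largest-∈ y S))
    partner-above : (∃ λ u′ → u′ ∈ S′ × AgreeUpTo M b u′) → b′ < largest S′
    partner-above (u′ , u′∈S′ , (_ , >M⇒>M)) = begin-strict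
      b′         ≡⟨ proj₁ (Pointwise.head agree) ≤-refl ⟩
      M          <⟨ >M⇒>M M<b ⟩
      u′         ≤⟨ ≤-largest u′∈S′ ⟩
      largest S′ ∎
      where open ≤-Reasoning

Φ-lower-head : ∀ b S {b′ S′} → Unique S → b < secondLargest S →
  Pointwise (AgreeUpTo (secondLargest (b ∷ S))) (Φ (b ∷ S)) (b′ ∷ S′) → b′ < largest S′
Φ-lower-head b S@(y ∷ _) {b′} {S′} u b<s ΦW≈ = partner-above (Pointwise-∈ (Pointwise.tail agree) M∈)
  where
    s = secondLargest S
    M = largest S
    agree : Pointwise (AgreeUpTo s) (b ∷ Φ S) (b′ ∷ S′)
    agree = subst₂ (λ t W → Pointwise (AgreeUpTo t) W (b′ ∷ S′)) (secondLargest-∷-below b S b<s)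
                   (Φ-step-below b S (Φ S) (<⇒≤ b<s)) ΦW≈
    M∈ : M ∈ Φ S
    M∈ = ∈-resp-↭ (↭-sym (Φ-↭ S u)) (largest-∈ y _)
    b<partner : ∀ {u′} → AgreeUpTo s M u′ → b < u′
    b<partner {u′} (≤s⇒≡ , >s⇒>) with m≤n⇒m<n∨m≡n (secondLargest≤largest S)
    ... | inj₁ s<M = <-trans b<s (>s⇒> s<M)
    ... | inj₂ s≡M = subst (b <_) (sym (≤s⇒≡ (≤-reflexive (sym s≡M)))) (<-≤-trans b<s (secondLargest≤largest S))
    partner-above : (∃ λ u′ → u′ ∈ S′ × AgreeUpTo s M u′) → b′ < largest S′
    partner-above (u′ , u′∈S′ , M≈u′) = begin-strict
      b′         ≡⟨ proj₁ (Pointwise.head agree) (<⇒≤ b<s) ⟩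
      b          <⟨ b<partner M≈u′ ⟩
      u′         ≤⟨ ≤-largest u′∈S′ ⟩
      largest S′ ∎
      where open ≤-Reasoning

Φ-second-head : ∀ b S {b′ S′} → Unique S → secondLargest S < b → b < largest S →
  Pointwise (AgreeUpTo (secondLargest (b ∷ S))) (Φ (b ∷ S)) (b′ ∷ S′) →
  b < b′ × S′ ↭ map (replace (largest S) b) S
Φ-second-head b S@(y ∷ _) {b′} {S′} u s<b b<M ΦW≈ =
  proj₂ (Pointwise.head agree) b<M ,
  subst (_↭ map g S) (sym (agree-≡ (Pointwise.tail agree) (≤b (Φ S) (∈-resp-↭ (Φ-↭ S u)))))
        (↭.map⁺ g (Φ-↭ S u))
  where
    M = largest S
    g = replace M b
    agree : Pointwise (AgreeUpTo b) (M ∷ map g (Φ S)) (b′ ∷ S′)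
    agree = subst₂ (λ t W → Pointwise (AgreeUpTo t) W (b′ ∷ S′)) (secondLargest-∷-between b S s<b b<M)
                   (Φ-step-above b S (Φ S) s<b) ΦW≈
    ≤b : ∀ V → (∀ {w} → w ∈ V → w ∈ S) → All (_≤ b) (map g V)
    ≤b []      _  = []
    ≤b (v ∷ V) V⊆ = replaced≤b ∷ ≤b V (V⊆ ∘ there)
      where
        replaced≤b : g v ≤ b
        replaced≤b with v ≟ M | largest⊎≤secondLargest (V⊆ (here refl))
        ... | yes refl | _        = ≤-reflexive (replace-self v b)
        ... | no v≢M   | inj₁ v≡M = ⊥-elim (v≢M v≡M)
        ... | no v≢M   | inj₂ v≤s = subst (_≤ b) (sym (replace-other v≢M)) (<⇒≤ (≤-<-trans v≤s s<b))

-- Σ over the splittings S = C ++ c ∷ D of Q C c D.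
countSplits : (List ℕ → ℕ → List ℕ → Bool) → List ℕ → ℕ
countSplits Q []      = 0
countSplits Q (x ∷ S) = indicator (Q [] x S) + countSplits (λ C c D → Q (x ∷ C) c D) S

countSplits-cong : ∀ {Q Q′} S → (∀ C c D → Q C c D ≡ Q′ C c D) → countSplits Q S ≡ countSplits Q′ S
countSplits-cong []      _    = refl
countSplits-cong (x ∷ S) Q≗Q′ = cong₂ _+_ (cong indicator (Q≗Q′ [] x S))
                                          (countSplits-cong S (λ C → Q≗Q′ (x ∷ C)))

countSplits-false : ∀ {Q} S → (∀ C c D → Q C c D ≡ false) → countSplits Q S ≡ 0
countSplits-false S Q≗false = trans (countSplits-cong S Q≗false) (never S)
  where
    never : ∀ S → countSplits (λ _ _ _ → false) S ≡ 0
    never []      = refl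
    never (_ ∷ S) = never S

between : ℕ → ℕ → ℕ → Bool
between a c v = (a <ᵇ v) ∧ (v <ᵇ c)

between-above : ∀ {a c v} → c ≤ v → between a c v ≡ false
between-above {a} {c} {v} c≤v rewrite <ᵇ-false {v} {c} c≤v = ∧-zeroʳ (a <ᵇ v)

between-inside : ∀ {a c v} → a < v → v < c → between a c v ≡ true
between-inside a<v v<c rewrite <ᵇ-true a<v | <ᵇ-true v<c = refl

all-between : ∀ a b L → b ∉ L → all (between a b) L ≡ (count (b <ᵇ_) L ≡ᵇ 0) ∧ all (a <ᵇ_) L
all-between a b []      _  = refl
all-between a b (x ∷ L) b∉ with <-cmp b x
... | tri≈ _ b≡x _ = ⊥-elim (b∉ (here b≡x))
... | tri< b<x _ _ rewrite <ᵇ-true b<x | between-above {a} (<⇒≤ b<x) = refl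
... | tri> _ _ x<b rewrite <ᵇ-false {b} (<⇒≤ x<b) | <ᵇ-true x<b | all-between a b L (b∉ ∘ there)
  with a <ᵇ x
... | true  = refl
... | false = sym (∧-zeroʳ _)

all-between-below : ∀ a c L → (∀ {v} → v ∈ L → v < c) → all (between a c) L ≡ all (a <ᵇ_) L
all-between-below a c []      _   = refl
all-between-below a c (x ∷ L) L<c rewrite <ᵇ-true (L<c (here refl)) | ∧-identityʳ (a <ᵇ x)
  = cong ((a <ᵇ x) ∧_) (all-between-below a c L (L<c ∘ there))

all-between-above : ∀ a c {v} L → v ∈ L → c ≤ v → all (between a c) L ≡ false
all-between-above a c (x ∷ L) (here refl) c≤v rewrite between-above {a} c≤v = refl
all-between-above a c (x ∷ L) (there v∈L) c≤v rewrite all-between-above a c L v∈L c≤v = ∧-zeroʳ _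

countSplits-123 : ∀ a b S → a < b → b ∉ S → a ∉ S →
  countSplits (λ C c D → all (between a b) C ∧ ((b <ᵇ c) ∧ all (between a b) D)) S
  ≡ indicator ((count (b <ᵇ_) S ≡ᵇ 1) ∧ all (a <ᵇ_) S)
countSplits-123 a b []      _   _  _  = refl
countSplits-123 a b (x ∷ S) a<b b∉ a∉ with <-cmp b x
... | tri≈ _ b≡x _ = ⊥-elim (b∉ (here b≡x))
... | tri< b<x _ _ rewrite <ᵇ-true b<x | <ᵇ-true (<-trans a<b b<x) | <ᵇ-false {x} {b} (<⇒≤ b<x)
                         | all-between a b S (b∉ ∘ there) | countSplits-false S (λ _ _ _ → refl) =
  +-identityʳ _
... | tri> _ _ x<b rewrite <ᵇ-false {b} (<⇒≤ x<b) with <-cmp a x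
...   | tri≈ _ a≡x _ = ⊥-elim (a∉ (here a≡x))
...   | tri< a<x _ _ rewrite between-inside a<x x<b | <ᵇ-true a<x =
  countSplits-123 a b S a<b (b∉ ∘ there) (a∉ ∘ there)
...   | tri> _ _ x<a rewrite <ᵇ-false {a} (<⇒≤ x<a) | countSplits-false S (λ _ _ _ → refl) =
  sym (cong indicator (∧-zeroʳ _))

countSplits-123-guarded : ∀ K a b S → (K ≡ true → a < b) → b ∉ S → a ∉ S →
  countSplits (λ C c D → K ∧ (all (between a b) C ∧ ((b <ᵇ c) ∧ all (between a b) D))) S
  ≡ indicator (K ∧ ((count (b <ᵇ_) S ≡ᵇ 1) ∧ all (a <ᵇ_) S))
countSplits-123-guarded false a b S _   _  _  = countSplits-false S (λ _ _ _ → refl)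
countSplits-123-guarded true  a b S a<b b∉ a∉ = countSplits-123 a b S (a<b refl) b∉ a∉

-- The first entry x of x ∷ S is the split point (first summand), or it joins the prefix P.
countSplits-132-∷ : ∀ a (H : ℕ → Bool) → (∀ {c} → H c ≡ true → a < c) → ∀ P x S → x ∉ S →
  indicator (all (between a x) P ∧ (H x ∧ all (between a x) S)) +
  indicator (nonEmpty S ∧ (all (between a (largest S)) (P ++ [ x ]) ∧ (H (largest S) ∧ all (a <ᵇ_) S)))
  ≡ indicator (all (between a (largest (x ∷ S))) P ∧ (H (largest (x ∷ S)) ∧ ((a <ᵇ x) ∧ all (a <ᵇ_) S)))
countSplits-132-∷ a H H⇒a< P x [] _ rewrite ⊔-identityʳ x =
  trans (+-identityʳ _) (cong indicator (∧-implied (H x) (<ᵇ-true ∘ H⇒a<) (all (between a x) P) true))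
countSplits-132-∷ a H H⇒a< P x S@(y ∷ S′) x∉S with <-cmp x (largest S)
... | tri≈ _ x≡M _ = ⊥-elim (x∉S (subst (_∈ S) (sym x≡M) (largest-∈ y S′)))
... | tri> _ _ M<x rewrite m≥n⇒m⊔n≡m (<⇒≤ M<x)
                         | all-between-above a (largest S) (P ++ [ x ]) (∈-++⁺ʳ P (here refl)) (<⇒≤ M<x)
                         | all-between-below a x S (λ v∈S → ≤-<-trans (≤-largest v∈S) M<x) =
  trans (+-identityʳ _) (cong indicator (∧-implied (H x) (<ᵇ-true ∘ H⇒a<) (all (between a x) P) (all (a <ᵇ_) S)))
... | tri< x<M _ _ rewrite m≤n⇒m⊔n≡n (<⇒≤ x<M)
                         | all-between-above a x S (largest-∈ y S′) (<⇒≤ x<M)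
                         | all-++ (between a (largest S)) P [ x ] | <ᵇ-true x<M =
  cong₂ (λ X Y → indicator X + indicator Y)
        (solve 2 (λ p h → p :* (h :* con false) := con false) refl (all (between a x) P) (H x))
        (solve 4 (λ p h q r → (p :* (q :* con true :* con true)) :* (h :* r) := p :* (h :* (q :* r))) refl
               (all (between a (largest S)) P) (H (largest S)) (a <ᵇ x) (all (a <ᵇ_) S))
  where open ∨-∧-Solver

countSplits-132 : ∀ a (H : ℕ → Bool) → (∀ {c} → H c ≡ true → a < c) → ∀ P S → Unique S →
  countSplits (λ C c D → all (between a c) (P ++ C) ∧ (H c ∧ all (between a c) D)) S
  ≡ indicator (nonEmpty S ∧ (all (between a (largest S)) P ∧ (H (largest S) ∧ all (a <ᵇ_) S)))
countSplits-132 a H H⇒a< P []      _        = refl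
countSplits-132 a H H⇒a< P (x ∷ S) (x∉ ∷ u) = begin
  indicator (all (between a x) (P ++ []) ∧ (H x ∧ all (between a x) S)) +
  countSplits (λ C c D → all (between a c) (P ++ x ∷ C) ∧ (H c ∧ all (between a c) D)) S
    ≡⟨ cong₂ _+_ (cong (λ Q → indicator (all (between a x) Q ∧ _)) (++-identityʳ P))
                 (countSplits-cong S (λ C c D → cong (λ Q → all (between a c) Q ∧ _) (sym (++-assoc P [ x ] C)))) ⟩
  indicator (all (between a x) P ∧ (H x ∧ all (between a x) S)) +
  countSplits (λ C c D → all (between a c) ((P ++ [ x ]) ++ C) ∧ (H c ∧ all (between a c) D)) S
    ≡⟨ cong (indicator (all (between a x) P ∧ (H x ∧ all (between a x) S)) +_)
            (countSplits-132 a H H⇒a< (P ++ [ x ]) S u) ⟩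
  indicator (all (between a x) P ∧ (H x ∧ all (between a x) S)) +
  indicator (nonEmpty S ∧ (all (between a (largest S)) (P ++ [ x ]) ∧ (H (largest S) ∧ all (a <ᵇ_) S)))
    ≡⟨ countSplits-132-∷ a H H⇒a< P x S (All¬⇒¬Any x∉) ⟩
  indicator (all (between a (largest (x ∷ S))) P ∧ (H (largest (x ∷ S)) ∧ ((a <ᵇ x) ∧ all (a <ᵇ_) S))) ∎
  where open ≡-Reasoning

avoids : ℕ → ℕ → List ℕ → Bool
avoids lo hi L = not (any (between lo hi) L)

column : List ℕ → List ℕ → List ℕ → List ℕ → ℕ → List ℕ
column A B C D 0 = A
column A B C D 1 = B
column A B C D 2 = C
column A B C D 3 = D
column A B C D _ = []

boxEmpty : (ℕ → List ℕ) → List ℕ → ℕ × ℕ → Bool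
boxEmpty col bounds (c , r) = avoids (nth bounds r) (nth bounds (suc r)) (col c)

LowerLeft : ℕ × ℕ → Set
LowerLeft (c , r) = c ≤ 1 × r ≤ 1

-- The conditions of E ∪ T on the entries A before and B between the first two positions of an
-- occurrence whose smallest value is a and whose middle value is t.
prefixOK : List (ℕ × ℕ) → List ℕ → List ℕ → ℕ → ℕ → Bool
prefixOK T A B a t = not (any (t <ᵇ_) A) ∧ all (boxEmpty (column A B [] []) (0 ∷ a ∷ t ∷ [])) T

guard132 : List (ℕ × ℕ) → List ℕ → ℕ → List ℕ → ℕ → ℕ → Bool
guard132 T A a B b c = ((a <ᵇ c) ∧ (c <ᵇ b)) ∧ prefixOK T A B a c

any-agree : ∀ {t} (f : ℕ → Bool) {L L′} → (∀ {u u′} → t < u → t < u′ → f u ≡ f u′) →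
            Pointwise (AgreeUpTo t) L L′ → any f L ≡ any f L′
any-agree f f-above []                        = refl
any-agree {t} f {u ∷ _} f-above ((≤t⇒≡ , >t⇒>) ∷ L≈L′) = cong₂ _∨_ head (any-agree f f-above L≈L′)
  where
    head : f u ≡ f _
    head with u ≤? t
    ... | yes u≤t = cong f (sym (≤t⇒≡ u≤t))
    ... | no u≰t  = f-above (≰⇒> u≰t) (>t⇒> (≰⇒> u≰t))

avoids-agree : ∀ {t L L′} lo hi → hi ≤ t → Pointwise (AgreeUpTo t) L L′ → avoids lo hi L ≡ avoids lo hi L′
avoids-agree lo hi hi≤t L≈L′ = cong not (any-agree _ above L≈L′)
  where
    above : ∀ {u u′} → _ < u → _ < u′ → (lo <ᵇ u) ∧ (u <ᵇ hi) ≡ (lo <ᵇ u′) ∧ (u′ <ᵇ hi)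
    above {u} {u′} t<u t<u′ rewrite <ᵇ-false {u} {hi} (<⇒≤ (≤-<-trans hi≤t t<u))
                                  | <ᵇ-false {u′} {hi} (<⇒≤ (≤-<-trans hi≤t t<u′)) =
      trans (∧-zeroʳ _) (sym (∧-zeroʳ _))

prefixOK-agree : ∀ T {A A′ B B′ a t} → All LowerLeft T → a ≤ t →
  Pointwise (AgreeUpTo t) A A′ → Pointwise (AgreeUpTo t) B B′ → prefixOK T A B a t ≡ prefixOK T A′ B′ a t
prefixOK-agree T {A} {A′} {B} {B′} {a} {t} lowerLeft a≤t A≈A′ B≈B′ =
  cong₂ _∧_ (cong not (any-agree (t <ᵇ_) (λ t<u t<u′ → trans (<ᵇ-true t<u) (sym (<ᵇ-true t<u′))) A≈A′))
            (boxes T lowerLeft)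
  where
    box : ∀ c r → LowerLeft (c , r) → boxEmpty (column A B [] []) (0 ∷ a ∷ t ∷ []) (c , r)
                                    ≡ boxEmpty (column A′ B′ [] []) (0 ∷ a ∷ t ∷ []) (c , r)
    box 0 0 _ = avoids-agree _ _ a≤t   A≈A′
    box 0 1 _ = avoids-agree _ _ ≤-refl A≈A′
    box 1 0 _ = avoids-agree _ _ a≤t   B≈B′
    box 1 1 _ = avoids-agree _ _ ≤-refl B≈B′
    box (suc (suc _)) _ (s≤s () , _)
    box _ (suc (suc _)) (_ , s≤s ())
    boxes : ∀ T → All LowerLeft T →
            all (boxEmpty (column A B [] []) (0 ∷ a ∷ t ∷ [])) T
            ≡ all (boxEmpty (column A′ B′ [] []) (0 ∷ a ∷ t ∷ [])) T
    boxes []            []               = refl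
    boxes ((c , r) ∷ T) (c,r≤1 ∷ lowerLeft) = cong₂ _∧_ (box c r c,r≤1) (boxes T lowerLeft)

avoids-all : ∀ lo hi L → avoids lo hi L ≡ all (not ∘ between lo hi) L
avoids-all lo hi = not-any (between lo hi)

record Fresh (n a b c v : ℕ) : Set where
  field
    ≢₁       : v ≢ a
    ≢₂       : v ≢ b
    ≢₃       : v ≢ c
    positive : 0 < v
    bounded  : v ≤ n

Fresh-swap : ∀ {n a b c v} → Fresh n a b c v → Fresh n a c b v
Fresh-swap f = record { ≢₁ = ≢₁ ; ≢₂ = ≢₃ ; ≢₃ = ≢₂ ; positive = positive ; bounded = bounded }
  where open Fresh f

outside-above : ∀ {t m n v} → t < m → v ≢ m → v ≤ n →
  not (between t m v) ∧ not (between m (suc n) v) ≡ not (t <ᵇ v)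
outside-above {t} {m} {n} {v} t<m v≢m v≤n with <-cmp v m
... | tri≈ _ v≡m _ = ⊥-elim (v≢m v≡m)
... | tri< v<m _ _ rewrite <ᵇ-true v<m | <ᵇ-false {m} (<⇒≤ v<m) | ∧-identityʳ (t <ᵇ v) = ∧-identityʳ _
... | tri> _ _ m<v rewrite <ᵇ-false {v} (<⇒≤ m<v) | <ᵇ-true m<v | <ᵇ-true (s≤s v≤n) | <ᵇ-true (<-trans t<m m<v) = refl

outside-rows : ∀ {a t m n v} → a < t → t < m → Fresh n a t m v →
  not (between 0 a v) ∧ (not (between t m v) ∧ not (between m (suc n) v)) ≡ between a t v
outside-rows {a} {t} {m} {n} {v} a<t t<m fresh rewrite <ᵇ-true (Fresh.positive fresh) with <-cmp v a
... | tri≈ _ v≡a _ = ⊥-elim (Fresh.≢₁ fresh v≡a)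
... | tri< v<a _ _ rewrite <ᵇ-true v<a | <ᵇ-false {a} (<⇒≤ v<a) = refl
... | tri> _ _ a<v rewrite <ᵇ-false {v} (<⇒≤ a<v) | <ᵇ-true a<v with <-cmp v t
...   | tri≈ _ v≡t _ = ⊥-elim (Fresh.≢₂ fresh v≡t)
...   | tri< v<t _ _ rewrite <ᵇ-true v<t | <ᵇ-false {t} (<⇒≤ v<t) | <ᵇ-false {m} (<⇒≤ (<-trans v<t t<m)) = refl
...   | tri> _ _ t<v rewrite <ᵇ-false {v} (<⇒≤ t<v) | <ᵇ-true t<v with <-cmp v m
...     | tri≈ _ v≡m _ = ⊥-elim (Fresh.≢₃ fresh v≡m)
...     | tri< v<m _ _ rewrite <ᵇ-true v<m = refl
...     | tri> _ _ m<v rewrite <ᵇ-false {v} (<⇒≤ m<v) | <ᵇ-true m<v | <ᵇ-true (s≤s (Fresh.bounded fresh)) = refl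

avoids-above : ∀ {a t m n} A → t < m → All (Fresh n a t m) A →
  avoids t m A ∧ avoids m (suc n) A ≡ not (any (t <ᵇ_) A)
avoids-above {a} {t} {m} {n} A t<m fresh = begin
  avoids t m A ∧ avoids m (suc n) A
    ≡⟨ cong₂ _∧_ (avoids-all t m A) (avoids-all m (suc n) A) ⟩
  all (not ∘ between t m) A ∧ all (not ∘ between m (suc n)) A
    ≡⟨ all-∧ _ _ A ⟩
  all (λ v → not (between t m v) ∧ not (between m (suc n) v)) A
    ≡⟨ all-cong-∈ A (λ v∈ → let f = All.lookup fresh v∈ in outside-above t<m (Fresh.≢₃ f) (Fresh.bounded f)) ⟩
  all (not ∘ (t <ᵇ_)) A
    ≡⟨ not-any (t <ᵇ_) A ⟨
  not (any (t <ᵇ_) A) ∎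
  where open ≡-Reasoning

avoids-outside : ∀ {a t m n} C → a < t → t < m → All (Fresh n a t m) C →
  avoids 0 a C ∧ (avoids t m C ∧ avoids m (suc n) C) ≡ all (between a t) C
avoids-outside {a} {t} {m} {n} C a<t t<m fresh = begin
  avoids 0 a C ∧ (avoids t m C ∧ avoids m (suc n) C)
    ≡⟨ cong₂ _∧_ (avoids-all 0 a C) (cong₂ _∧_ (avoids-all t m C) (avoids-all m (suc n) C)) ⟩
  all (not ∘ between 0 a) C ∧ (all (not ∘ between t m) C ∧ all (not ∘ between m (suc n)) C)
    ≡⟨ cong (all (not ∘ between 0 a) C ∧_) (all-∧ _ _ C) ⟩
  all (not ∘ between 0 a) C ∧ all (λ v → not (between t m v) ∧ not (between m (suc n) v)) C
    ≡⟨ all-∧ _ _ C ⟩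
  all (λ v → not (between 0 a v) ∧ (not (between t m v) ∧ not (between m (suc n) v))) C
    ≡⟨ all-cong-∈ C (λ v∈ → outside-rows a<t t<m (All.lookup fresh v∈)) ⟩
  all (between a t) C ∎
  where open ≡-Reasoning

lowerLeft-boxes : ∀ T → All LowerLeft T → ∀ {n a t m} A B C D →
  all (boxEmpty (column A B C D) (0 ∷ a ∷ t ∷ m ∷ suc n ∷ [])) T
  ≡ all (boxEmpty (column A B [] []) (0 ∷ a ∷ t ∷ [])) T
lowerLeft-boxes T lowerLeft {n} {a} {t} {m} A B C D = all-cong-∈ T (λ box∈ → box _ (All.lookup lowerLeft box∈))
  where
    box : ∀ cr → LowerLeft cr →
          boxEmpty (column A B C D) (0 ∷ a ∷ t ∷ m ∷ suc n ∷ []) cr ≡ boxEmpty (column A B [] []) (0 ∷ a ∷ t ∷ []) cr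
    box (0 , 0) _ = refl
    box (0 , 1) _ = refl
    box (1 , 0) _ = refl
    box (1 , 1) _ = refl
    box (suc (suc _) , _) (s≤s () , _)
    box (_ , suc (suc _)) (_ , s≤s ())

boxes-E++T : ∀ T → All LowerLeft T → ∀ {n a t m} A B C D → a < t → t < m →
  All (Fresh n a t m) A → All (Fresh n a t m) C → All (Fresh n a t m) D →
  all (boxEmpty (column A B C D) (0 ∷ a ∷ t ∷ m ∷ suc n ∷ [])) (E ++ T)
  ≡ prefixOK T A B a t ∧ (all (between a t) C ∧ all (between a t) D)
boxes-E++T T lowerLeft {n} {a} {t} {m} A B C D a<t t<m freshA freshC freshD = begin
  all box (E ++ T)    ≡⟨ all-++ box E T ⟩
  all box E ∧ all box T
    ≡⟨ solve 9 (λ b₀₂ b₀₃ b₂₀ b₂₂ b₂₃ b₃₀ b₃₂ b₃₃ bT →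
                 (b₀₂ :* (b₀₃ :* (b₂₀ :* (b₂₂ :* (b₂₃ :* (b₃₀ :* (b₃₂ :* (b₃₃ :* con true)))))))) :* bT
                 := ((b₀₂ :* b₀₃) :* bT) :* ((b₂₀ :* (b₂₂ :* b₂₃)) :* (b₃₀ :* (b₃₂ :* b₃₃)))) refl
             (avoids t m A) (avoids m (suc n) A) (avoids 0 a C) (avoids t m C) (avoids m (suc n) C)
             (avoids 0 a D) (avoids t m D) (avoids m (suc n) D) (all box T) ⟩
  ((avoids t m A ∧ avoids m (suc n) A) ∧ all box T) ∧
  ((avoids 0 a C ∧ (avoids t m C ∧ avoids m (suc n) C)) ∧ (avoids 0 a D ∧ (avoids t m D ∧ avoids m (suc n) D)))
    ≡⟨ cong₂ _∧_ (cong₂ _∧_ (avoids-above A t<m freshA) (lowerLeft-boxes T lowerLeft A B C D))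
                 (cong₂ _∧_ (avoids-outside C a<t t<m freshC) (avoids-outside D a<t t<m freshD)) ⟩
  prefixOK T A B a t ∧ (all (between a t) C ∧ all (between a t) D) ∎
  where
    open ≡-Reasoning
    open ∨-∧-Solver
    box = boxEmpty (column A B C D) (0 ∷ a ∷ t ∷ m ∷ suc n ∷ [])

-- Reading an occurrence off a decomposition of π

-- isOccurrence with its local entry function m ↦ π_m abstracted as g, so that it can be reasoned about.
orderIsoWith : (ℕ → ℕ) → MeshPattern → List ℕ → Bool
orderIsoWith g p is = all (λ a → all (λ b →
  (nth (map g is) a <ᵇ nth (map g is) b) ==ᴮ (nth (τ p) a <ᵇ nth (τ p) b)) (indices (k p))) (indices (k p))

boxOKWith : (ℕ → ℕ) → ℕ → List ℕ → ℕ × ℕ → Bool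
boxOKWith g n is (a , b) = not (any (λ m →
  (nth iExt a <ᵇ m) ∧ (m <ᵇ nth iExt (suc a)) ∧ (nth vExt b <ᵇ g m) ∧ (g m <ᵇ nth vExt (suc b))) (range1 n))
  where
    iExt = 0 ∷ (is ++ (suc n ∷ []))
    vExt = 0 ∷ (sort (map g is) ++ (suc n ∷ []))

occurrenceWith : (ℕ → ℕ) → MeshPattern → List ℕ → List ℕ → Bool
occurrenceWith g p π is = orderIsoWith g p is ∧ all (boxOKWith g (length π) is) (R p)

isOccurrence-with-entry : ∀ p π is →
  ∃ λ g → (∀ m → g (suc m) ≡ nth π m) × isOccurrence p π is ≡ occurrenceWith g p π is
isOccurrence-with-entry p π is = _ , (λ _ → refl) , refl  -- unification finds the local entry function

any-entries : ∀ {g : ℕ → ℕ} {π} (Q : ℕ → Bool) → (∀ m → g (suc m) ≡ nth π m) → ∀ X Y Z → π ≡ X ++ Y ++ Z →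
              any (Q ∘ g) (interval (suc (length X)) (length Y)) ≡ any Q Y
any-entries Q g≡ X []      Z π≡ = refl
any-entries {g} Q g≡ X (y ∷ Y) Z π≡ = cong₂ _∨_ (cong Q entry) (begin
  any (Q ∘ g) (interval (2 + length X) (length Y))
    ≡⟨ cong (λ m → any (Q ∘ g) (interval (suc m) (length Y))) (sym (length-snoc X y)) ⟩
  any (Q ∘ g) (interval (suc (length (X ++ [ y ]))) (length Y))
    ≡⟨ any-entries Q g≡ (X ++ [ y ]) Y Z (trans π≡ (sym (++-assoc X [ y ] (Y ++ Z)))) ⟩
  any Q Y ∎)
  where
    open ≡-Reasoning
    entry : g (suc (length X)) ≡ y
    entry = trans (g≡ (length X)) (trans (cong (λ π → nth π (length X)) π≡) (nth-++ X y (Y ++ Z)))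

any-positions : ∀ {g : ℕ → ℕ} {π} (Q : ℕ → Bool) → (∀ m → g (suc m) ≡ nth π m) → ∀ X Y Z → π ≡ X ++ Y ++ Z →
  ∀ {lo hi} → lo ≡ length X → hi ≡ suc (lo + length Y) →
  any (λ m → (lo <ᵇ m) ∧ ((m <ᵇ hi) ∧ Q (g m))) (range1 (length π)) ≡ any Q Y
any-positions {g} {π} Q g≡ X Y Z π≡ {lo} {hi} refl refl = begin
  any F (range1 (length π))
    ≡⟨ cong (any F) (trans (range1≡interval (length π)) (cong (interval 1) length-π)) ⟩
  any F (interval 1 (lo + (length Y + length Z)))
    ≡⟨ cong (any F) (trans (interval-+ 1 lo _)
                           (cong (interval 1 lo ++_) (interval-+ (suc lo) (length Y) (length Z)))) ⟩
  any F (interval 1 lo ++ interval (suc lo) (length Y) ++ interval (suc lo + length Y) (length Z))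
    ≡⟨ trans (any-++ F (interval 1 lo) _)
             (cong (any F (interval 1 lo) ∨_) (any-++ F (interval (suc lo) (length Y)) _)) ⟩
  any F (interval 1 lo) ∨ (any F (interval (suc lo) (length Y)) ∨ any F (interval (suc lo + length Y) (length Z)))
    ≡⟨ cong₂ (λ u w → u ∨ (any F (interval (suc lo) (length Y)) ∨ w)) before after ⟩
  false ∨ (any F (interval (suc lo) (length Y)) ∨ false)
    ≡⟨ ∨-identityʳ _ ⟩
  any F (interval (suc lo) (length Y))
    ≡⟨ any-cong-∈ (interval (suc lo) (length Y)) inside ⟩
  any (Q ∘ g) (interval (suc lo) (length Y))
    ≡⟨ any-entries Q g≡ X Y Z π≡ ⟩
  any Q Y ∎
  where
    open ≡-Reasoning
    F : ℕ → Bool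
    F m = (lo <ᵇ m) ∧ ((m <ᵇ suc (lo + length Y)) ∧ Q (g m))
    length-π : length π ≡ lo + (length Y + length Z)
    length-π = trans (cong length π≡) (trans (length-++ X) (cong (lo +_) (length-++ Y)))
    before : any F (interval 1 lo) ≡ false
    before = any-false (interval 1 lo) λ {m} m∈ →
      cong (_∧ ((m <ᵇ suc (lo + length Y)) ∧ Q (g m))) (<ᵇ-false (≤-pred (proj₂ (∈-interval 1 lo m∈))))
    after : any F (interval (suc lo + length Y) (length Z)) ≡ false
    after = any-false (interval _ (length Z)) λ {m} m∈ →
      trans (cong (λ b → (lo <ᵇ m) ∧ (b ∧ Q (g m))) (<ᵇ-false (proj₁ (∈-interval _ (length Z) m∈))))
            (∧-zeroʳ (lo <ᵇ m))
    inside : ∀ {m} → m ∈ interval (suc lo) (length Y) → F m ≡ Q (g m)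
    inside {m} m∈ with ∈-interval (suc lo) (length Y) m∈
    ... | lo<m , m<hi rewrite <ᵇ-true lo<m | <ᵇ-true m<hi = refl

orderIso3 : List ℕ → ℕ → ℕ → ℕ → Bool
orderIso3 τ x y z = all (λ a → all (λ b →
  (nth (x ∷ y ∷ z ∷ []) a <ᵇ nth (x ∷ y ∷ z ∷ []) b) ==ᴮ (nth τ a <ᵇ nth τ b)) (indices 3)) (indices 3)

orderIso3-123 : ∀ {x y z} → x ≢ y → y ≢ z → x ≢ z → orderIso3 (1 ∷ 2 ∷ 3 ∷ []) x y z ≡ (x <ᵇ y) ∧ (y <ᵇ z)
orderIso3-123 {x} {y} {z} x≢y y≢z x≢z
  rewrite <ᵇ-false {x} ≤-refl | <ᵇ-false {y} ≤-refl | <ᵇ-false {z} ≤-refl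
        | <ᵇ-flip x≢y | <ᵇ-flip y≢z | <ᵇ-flip x≢z
  with x <ᵇ y in x<y | y <ᵇ z in y<z | x <ᵇ z in x<z
... | true  | true  | true  = refl
... | true  | true  | false with () ← trans (sym (<ᵇ-trans x y z x<y y<z)) x<z
... | true  | false | true  = refl
... | true  | false | false = refl
... | false | true  | true  = refl
... | false | true  | false = refl
... | false | false | true  with () ← trans (sym (≮ᵇ-trans x y z x<y y<z)) x<z
... | false | false | false = refl

orderIso3-132 : ∀ {x y z} → x ≢ y → y ≢ z → x ≢ z → orderIso3 (1 ∷ 3 ∷ 2 ∷ []) x y z ≡ (x <ᵇ z) ∧ (z <ᵇ y)
orderIso3-132 {x} {y} {z} x≢y y≢z x≢z
  rewrite <ᵇ-false {x} ≤-refl | <ᵇ-false {y} ≤-refl | <ᵇ-false {z} ≤-refl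
        | <ᵇ-flip x≢y | <ᵇ-flip y≢z | <ᵇ-flip x≢z
  with x <ᵇ y in x<y | y <ᵇ z in y<z | x <ᵇ z in x<z
... | true  | true  | true  = refl
... | true  | true  | false with () ← trans (sym (<ᵇ-trans x y z x<y y<z)) x<z
... | true  | false | true  = refl
... | true  | false | false = refl
... | false | true  | true  = refl
... | false | true  | false = refl
... | false | false | true  with () ← trans (sym (≮ᵇ-trans x y z x<y y<z)) x<z
... | false | false | false = refl

sort-123 : ∀ {x y z} → x < y → y < z → sort (x ∷ y ∷ z ∷ []) ≡ x ∷ y ∷ z ∷ []
sort-123 x<y y<z rewrite ≤ᵇ-true (<⇒≤ y<z) | ≤ᵇ-true (<⇒≤ x<y) = refl

sort-132 : ∀ {x y z} → x < z → z < y → sort (x ∷ y ∷ z ∷ []) ≡ x ∷ z ∷ y ∷ []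
sort-132 x<z z<y rewrite ≤ᵇ-false z<y | ≤ᵇ-true (<⇒≤ x<z) = refl

occursAt : List ℕ → List (ℕ × ℕ) → ℕ → List ℕ → List ℕ → List ℕ → List ℕ → ℕ → ℕ → ℕ → Bool
occursAt τ R n A B C D x y z =
  orderIso3 τ x y z ∧ all (boxEmpty (column A B C D) (0 ∷ sort (x ∷ y ∷ z ∷ []) ++ [ suc n ])) R

module _ {g : ℕ → ℕ} {π : List ℕ} (g≡ : ∀ m → g (suc m) ≡ nth π m)
         (A : List ℕ) (a : ℕ) (B : List ℕ) (b : ℕ) (C : List ℕ) (c : ℕ) (D : List ℕ)
         (π≡ : π ≡ A ++ a ∷ B ++ b ∷ C ++ c ∷ D) where

  private
    P : List ℕ
    P = A ++ a ∷ B
    n : ℕ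
    n = length π
    positions : List ℕ
    positions = suc (length A) ∷ suc (length P) ∷ suc (suc (length P + length C)) ∷ []
    bounds : List ℕ
    bounds = 0 ∷ (sort (map g positions) ++ [ suc n ])
    row : ℕ → ℕ → Bool
    row r = between (nth bounds r) (nth bounds (suc r))
    π≡P : π ≡ P ++ b ∷ C ++ c ∷ D
    π≡P = trans π≡ (sym (++-assoc A (a ∷ B) _))
    π≡PbC : π ≡ (P ++ b ∷ C) ++ c ∷ D
    π≡PbC = trans π≡P (sym (++-assoc P (b ∷ C) _))
    length-PbC : length (P ++ b ∷ C) ≡ suc (length P + length C)
    length-PbC = trans (length-++ P) (+-suc (length P) (length C))
    entry : ∀ X {y Z} → π ≡ X ++ y ∷ Z → g (suc (length X)) ≡ y
    entry X {y} {Z} π≡X = trans (g≡ (length X)) (trans (cong (λ l → nth l (length X)) π≡X) (nth-++ X y Z))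

  boxOKWith-column : ∀ col r → col ≤ 3 →
    boxOKWith g n positions (col , r) ≡ boxEmpty (column A B C D) bounds (col , r)
  boxOKWith-column 0 r _ = cong not (any-positions (row r) g≡ [] A (a ∷ B ++ b ∷ C ++ c ∷ D) π≡ refl refl)
  boxOKWith-column 1 r _ = cong not (any-positions (row r) g≡ (A ++ [ a ]) B (b ∷ C ++ c ∷ D)
    (trans π≡ (sym (++-assoc A [ a ] _))) (sym (length-snoc A a))
    (cong suc (trans (length-++ A) (+-suc (length A) (length B)))))
  boxOKWith-column 2 r _ = cong not (any-positions (row r) g≡ (P ++ [ b ]) C (c ∷ D)
    (trans π≡P (sym (++-assoc P [ b ] _))) (sym (length-snoc P b)) refl)
  boxOKWith-column 3 r _ = cong not (any-positions (row r) g≡ ((P ++ b ∷ C) ++ [ c ]) D []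
    (trans π≡PbC (trans (sym (++-assoc (P ++ b ∷ C) [ c ] D))
                        (cong (((P ++ b ∷ C) ++ [ c ]) ++_) (sym (++-identityʳ D)))))
    (sym (trans (length-snoc (P ++ b ∷ C) c) (cong suc length-PbC)))
    (cong suc (trans (cong length π≡PbC)
                     (trans (length-++ (P ++ b ∷ C)) (trans (cong (_+ suc (length D)) length-PbC) (+-suc _ (length D)))))))
  boxOKWith-column (suc (suc (suc (suc _)))) r (s≤s (s≤s (s≤s ())))

  occurrenceWith-split : ∀ τ R → All (λ box → proj₁ box ≤ 3) R →
    occurrenceWith g (mesh 3 τ R) π positions ≡ occursAt τ R n A B C D a b c
  occurrenceWith-split τ R R≤3 =
    trans (cong (orderIsoWith g (mesh 3 τ R) positions ∧_)
                (all-cong-∈ R (λ {box} box∈ → boxOKWith-column (proj₁ box) (proj₂ box) (All.lookup R≤3 box∈))))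
          (cong₃ (occursAt τ R n A B C D) (entry A π≡) (entry P π≡P)
                 (subst (λ m → g (suc m) ≡ c) length-PbC (entry (P ++ b ∷ C) π≡PbC)))
    where
      cong₃ : ∀ (f : ℕ → ℕ → ℕ → Bool) {x x′ y y′ z z′} → x ≡ x′ → y ≡ y′ → z ≡ z′ → f x y z ≡ f x′ y′ z′
      cong₃ f refl refl refl = refl

isOccurrence-split : ∀ τ R A a B b C c D {π} → π ≡ A ++ a ∷ B ++ b ∷ C ++ c ∷ D → All (λ box → proj₁ box ≤ 3) R →
  isOccurrence (mesh 3 τ R) π
    (suc (length A) ∷ suc (length (A ++ a ∷ B)) ∷ suc (suc (length (A ++ a ∷ B) + length C)) ∷ [])
  ≡ occursAt τ R (length π) A B C D a b c
isOccurrence-split τ R A a B b C c D {π} π≡ R≤3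
  with isOccurrence-with-entry (mesh 3 τ R) π
         (suc (length A) ∷ suc (length (A ++ a ∷ B)) ∷ suc (suc (length (A ++ a ∷ B) + length C)) ∷ [])
... | g , g≡ , occ≡ = trans occ≡ (occurrenceWith-split {g} g≡ A a B b C c D π≡ τ R R≤3)

occursAt-123 : ∀ T → All LowerLeft T → ∀ {n A B C D a b c} → a ≢ b → b ≢ c → a ≢ c →
  All (Fresh n a b c) A → All (Fresh n a b c) C → All (Fresh n a b c) D →
  occursAt (1 ∷ 2 ∷ 3 ∷ []) (E ++ T) n A B C D a b c
  ≡ ((a <ᵇ b) ∧ prefixOK T A B a b) ∧ (all (between a b) C ∧ ((b <ᵇ c) ∧ all (between a b) D))
occursAt-123 T lowerLeft {n} {A} {B} {C} {D} {a} {b} {c} a≢b b≢c a≢c freshA freshC freshD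
  rewrite orderIso3-123 a≢b b≢c a≢c with a <ᵇ b in a<b | b <ᵇ c in b<c
... | false | _     = refl
... | true  | false =
  sym (solve 2 (λ p q → p :* (q :* con false) := con false) refl (prefixOK T A B a b) (all (between a b) C))
  where open ∨-∧-Solver
... | true  | true rewrite sort-123 (<ᵇ-true⁻ {a} {b} a<b) (<ᵇ-true⁻ {b} {c} b<c) =
  boxes-E++T T lowerLeft A B C D (<ᵇ-true⁻ {a} {b} a<b) (<ᵇ-true⁻ {b} {c} b<c) freshA freshC freshD

occursAt-132 : ∀ T → All LowerLeft T → ∀ {n A B C D a b c} → a ≢ b → b ≢ c → a ≢ c →
  All (Fresh n a b c) A → All (Fresh n a b c) C → All (Fresh n a b c) D →
  occursAt (1 ∷ 3 ∷ 2 ∷ []) (E ++ T) n A B C D a b c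
  ≡ all (between a c) C ∧ (guard132 T A a B b c ∧ all (between a c) D)
occursAt-132 T lowerLeft {n} {A} {B} {C} {D} {a} {b} {c} a≢b b≢c a≢c freshA freshC freshD
  rewrite orderIso3-132 a≢b b≢c a≢c with a <ᵇ c in a<c | c <ᵇ b in c<b
... | false | _     = sym (∧-zeroʳ _)
... | true  | false = sym (∧-zeroʳ _)
... | true  | true rewrite sort-132 (<ᵇ-true⁻ {a} {c} a<c) (<ᵇ-true⁻ {c} {b} c<b) =
  trans (boxes-E++T T lowerLeft A B C D (<ᵇ-true⁻ {a} {c} a<c) (<ᵇ-true⁻ {c} {b} c<b)
                    (All.map Fresh-swap freshA) (All.map Fresh-swap freshC) (All.map Fresh-swap freshD))
        (solve 3 (λ p q r → p :* (q :* r) := q :* (p :* r)) refl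
               (prefixOK T A B a c) (all (between a c) C) (all (between a c) D))
  where open ∨-∧-Solver

count-positions : ∀ S j (F : ℕ → Bool) (Q : List ℕ → ℕ → List ℕ → Bool) →
  (∀ C c D → C ++ c ∷ D ≡ S → F (suc (j + length C)) ≡ Q C c D) →
  count F (interval (suc j) (length S)) ≡ countSplits Q S
count-positions []      j F Q F≡Q = refl
count-positions (x ∷ S) j F Q F≡Q =
  cong₂ _+_ (cong indicator (trans (cong (F ∘ suc) (sym (+-identityʳ j))) (F≡Q [] x S refl)))
            (count-positions S (suc j) F (λ C → Q (x ∷ C))
              (λ C c D S≡ → trans (cong (F ∘ suc) (sym (+-suc j (length C)))) (F≡Q (x ∷ C) c D (cong (x ∷_) S≡))))

InRange : ℕ → List ℕ → Set
InRange n π = ∀ {v} → v ∈ π → 0 < v × v ≤ n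

fresh-split : ∀ {n π} A a B b C c D → π ≡ A ++ a ∷ B ++ b ∷ C ++ c ∷ D → Unique π → InRange n π →
  a ≢ b × b ≢ c × a ≢ c × All (Fresh n a b c) A × All (Fresh n a b c) C × All (Fresh n a b c) D
fresh-split {n} {π} A a B b C c D refl u inRange with Unique-resp-↭ (↭-pull-three A a B b C c D) u
... | (a≢b ∷ a≢c ∷ a≢rest) ∷ (b≢c ∷ b≢rest) ∷ c≢rest ∷ _ =
  a≢b , b≢c , a≢c , All.tabulate (fresh ∘ ∈-++⁺ˡ ∘ ∈-++⁺ˡ ∘ ∈-++⁺ˡ)
                  , All.tabulate (fresh ∘ ∈-++⁺ˡ ∘ ∈-++⁺ʳ (A ++ B)) , All.tabulate (fresh ∘ ∈-++⁺ʳ _)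
  where
    fresh : ∀ {v} → v ∈ ((A ++ B) ++ C) ++ D → Fresh n a b c v
    fresh v∈ = record
      { ≢₁ = λ v≡a → All.lookup a≢rest v∈ (sym v≡a)
      ; ≢₂ = λ v≡b → All.lookup b≢rest v∈ (sym v≡b)
      ; ≢₃ = λ v≡c → All.lookup c≢rest v∈ (sym v≡c)
      ; positive = proj₁ in-range
      ; bounded  = proj₂ in-range
      }
      where in-range = inRange (∈-resp-↭ (↭-sym (↭-pull-three A a B b C c D)) (there (there (there v∈))))

unique-split : ∀ (A : List ℕ) a B b S → Unique (A ++ a ∷ B ++ b ∷ S) → Unique (b ∷ S) × a ∉ S × a ≢ b
unique-split A a B b S u with Unique-++⁻ʳ A u
... | a∉ ∷ u′ = Unique-++⁻ʳ B u′ , (All¬⇒¬Any a∉ ∘ ∈-++⁺ʳ B ∘ there) , (All¬⇒¬Any a∉ ∘ ∈-++⁺ʳ B ∘ here)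

-- Occurrences through two fixed positions

-- Whether the entries a and b following A and B in π = A a B b S are the first two entries of an
-- occurrence of (123, E ∪ T) in π; its third entry is then determined.
completes123 : List (ℕ × ℕ) → List ℕ → ℕ → List ℕ → ℕ → List ℕ → Bool
completes123 T A a B b S = ((a <ᵇ b) ∧ prefixOK T A B a b) ∧ ((count (b <ᵇ_) S ≡ᵇ 1) ∧ all (a <ᵇ_) S)

completes132 : List (ℕ × ℕ) → List ℕ → ℕ → List ℕ → ℕ → List ℕ → Bool
completes132 T A a B b S = nonEmpty S ∧ (guard132 T A a B b (largest S) ∧ all (a <ᵇ_) S)

completes132-false : ∀ T A a B {b} S → b < largest S → completes132 T A a B b S ≡ false
completes132-false T A a B {b} S b<M rewrite <ᵇ-false {largest S} {b} (<⇒≤ b<M) =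
  solve 4 (λ n p q r → n :* (((p :* con false) :* q) :* r) := con false) refl
        (nonEmpty S) (a <ᵇ largest S) (prefixOK T A B a (largest S)) (all (a <ᵇ_) S)
  where open ∨-∧-Solver

completes123-false : ∀ T A a B b S → count (b <ᵇ_) S ≢ 1 → completes123 T A a B b S ≡ false
completes123-false T A a B b S count≢1 rewrite ≡ᵇ-false count≢1 = ∧-zeroʳ _

completes123≡completes132-second : ∀ T → All LowerLeft T → ∀ {A a B b y S A′ a′ B′ b′ S′} → a ≢ b →
  secondLargest (y ∷ S) < b → b < largest (y ∷ S) → b < b′ → S′ ↭ map (replace (largest (y ∷ S)) b) (y ∷ S) →
  Pointwise (AgreeUpTo b) A A′ → AgreeUpTo b a a′ → Pointwise (AgreeUpTo b) B B′ →
  completes123 T A a B b (y ∷ S) ≡ completes132 T A′ a′ B′ b′ S′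
completes123≡completes132-second T lowerLeft {A} {a} {B} {b} {y} {S} {A′} {a′} {B′} {b′} {S′}
                                 a≢b s<b b<M b<b′ S′↭ A≈ (≤b⇒≡ , >b⇒>) B≈
  rewrite count-above-second b (y ∷ S) s<b b<M | nonEmpty-↭ S′↭ | trans (largest-↭ S′↭) (largest-replace-largest y S s<b)
  with <-cmp a b
... | tri≈ _ a≡b _ = ⊥-elim (a≢b a≡b)
... | tri> _ _ b<a rewrite <ᵇ-false {a} (<⇒≤ b<a) | <ᵇ-false {a′} (<⇒≤ (>b⇒> b<a)) = refl
... | tri< a<b _ _ rewrite ≤b⇒≡ (<⇒≤ a<b) | <ᵇ-true a<b | <ᵇ-true b<b′
                        | prefixOK-agree T lowerLeft (<⇒≤ a<b) A≈ B≈
                        | all-↭ (a <ᵇ_) S′↭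
                        | all-map-replace a (largest (y ∷ S)) b (y ∷ S) a<b (<-trans a<b b<M) = refl

completes123≡completes132-Φ : ∀ T → All LowerLeft T → ∀ {A a B b S A′ a′ B′ b′ S′} → Unique (b ∷ S) → a ≢ b → 0 < b →
  Pointwise (AgreeUpTo (secondLargest (b ∷ S))) A A′ → AgreeUpTo (secondLargest (b ∷ S)) a a′ →
  Pointwise (AgreeUpTo (secondLargest (b ∷ S))) B B′ →
  Pointwise (AgreeUpTo (secondLargest (b ∷ S))) (Φ (b ∷ S)) (b′ ∷ S′) →
  completes123 T A a B b S ≡ completes132 T A′ a′ B′ b′ S′
completes123≡completes132-Φ T _ {S = []} _ _ _ _ _ _ (_ ∷ []) = ∧-zeroʳ _
completes123≡completes132-Φ T lowerLeft {A} {a} {B} {b} {S@(y ∷ S₀)} {A′} {a′} {B′} {b′} {S′}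
                            (b∉ ∷ u) a≢b 0<b A≈ a≈ B≈ ΦW≈
  with <-cmp b (largest S)
... | tri≈ _ b≡M _ = ⊥-elim (All¬⇒¬Any b∉ (subst (_∈ S) (sym b≡M) (largest-∈ y S₀)))
... | tri> _ _ M<b =
  trans (completes123-false T A a B b S (λ c≡1 → 0≢1+n (trans (sym (count-above-largest b S M<b)) c≡1)))
        (sym (completes132-false T A′ a′ B′ S′ (Φ-largest-head b y S₀ u M<b ΦW≈)))
... | tri< b<M _ _ with <-cmp b (secondLargest S)
...   | tri< b<s _ _ =
  trans (completes123-false T A a B b S (λ c≡1 → <⇒≱ (count-above-below b S b<s) (≤-reflexive c≡1)))
        (sym (completes132-false T A′ a′ B′ S′ (Φ-lower-head b S u b<s ΦW≈)))
...   | tri≈ _ b≡s _ = ⊥-elim (secondLargest≢ S 0<b (All¬⇒¬Any b∉) (sym b≡s))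
...   | tri> _ _ s<b with Φ-second-head b S u s<b b<M ΦW≈
...     | b<b′ , S′↭ = completes123≡completes132-second T lowerLeft a≢b s<b b<M b<b′ S′↭
                           (at-b A≈) (subst (λ t → AgreeUpTo t a a′) t≡b a≈) (at-b B≈)
  where
    t≡b : secondLargest (b ∷ S) ≡ b
    t≡b = secondLargest-∷-between b S s<b b<M
    at-b : ∀ {X X′} → Pointwise (AgreeUpTo (secondLargest (b ∷ S))) X X′ → Pointwise (AgreeUpTo b) X X′
    at-b = subst (λ t → Pointwise (AgreeUpTo t) _ _) t≡b

module _ (T : List (ℕ × ℕ)) (lowerLeft : All LowerLeft T)
         {π : List ℕ} (A : List ℕ) (a : ℕ) (B : List ℕ) (b : ℕ) (S : List ℕ)
         (π≡ : π ≡ A ++ a ∷ B ++ b ∷ S) (u : Unique π) (inRange : InRange (length π) π) where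

  private
    P : List ℕ
    P = A ++ a ∷ B
    E++T≤3 : All (λ box → proj₁ box ≤ 3) (E ++ T)
    E++T≤3 = z≤n ∷ z≤n ∷ 2≤3 ∷ 2≤3 ∷ 2≤3 ∷ ≤-refl ∷ ≤-refl ∷ ≤-refl
           ∷ All.map (λ (c≤1 , _) → ≤-trans c≤1 (s≤s z≤n)) lowerLeft
      where 2≤3 = s≤s (s≤s z≤n)
    occurs : ∀ τ C c D → C ++ c ∷ D ≡ S →
      isOccurrence (mesh 3 τ (E ++ T)) π (suc (length A) ∷ suc (length P) ∷ suc (suc (length P + length C)) ∷ [])
      ≡ occursAt τ (E ++ T) (length π) A B C D a b c
    occurs τ C c D refl = isOccurrence-split τ (E ++ T) A a B b C c D π≡ E++T≤3
    fresh : ∀ C c D → C ++ c ∷ D ≡ S →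
      a ≢ b × b ≢ c × a ≢ c ×
      All (Fresh (length π) a b c) A × All (Fresh (length π) a b c) C × All (Fresh (length π) a b c) D
    fresh C c D refl = fresh-split A a B b C c D π≡ u inRange

  occurrences-123-at :
    count (λ k → isOccurrence (p123 T) π (suc (length A) ∷ suc (length P) ∷ k ∷ []))
          (interval (suc (suc (length P))) (length S))
    ≡ indicator (completes123 T A a B b S)
  occurrences-123-at with unique-split A a B b S (subst Unique π≡ u)
  ... | b∉ ∷ _ , a∉S , _ =
    trans (count-positions S (suc (length P)) _ _ at-k)
          (countSplits-123-guarded ((a <ᵇ b) ∧ prefixOK T A B a b) a b S
                                   (<ᵇ-true⁻ ∘ ∧-conicalˡ (a <ᵇ b) _) (All¬⇒¬Any b∉) a∉S)
    where
      at-k : ∀ C c D → C ++ c ∷ D ≡ S →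
        isOccurrence (p123 T) π (suc (length A) ∷ suc (length P) ∷ suc (suc (length P + length C)) ∷ [])
        ≡ ((a <ᵇ b) ∧ prefixOK T A B a b) ∧ (all (between a b) C ∧ ((b <ᵇ c) ∧ all (between a b) D))
      at-k C c D S≡ with fresh C c D S≡
      ... | a≢b , b≢c , a≢c , fA , fC , fD =
        trans (occurs (1 ∷ 2 ∷ 3 ∷ []) C c D S≡) (occursAt-123 T lowerLeft a≢b b≢c a≢c fA fC fD)

  occurrences-132-at :
    count (λ k → isOccurrence (p132 T) π (suc (length A) ∷ suc (length P) ∷ k ∷ []))
          (interval (suc (suc (length P))) (length S))
    ≡ indicator (completes132 T A a B b S)
  occurrences-132-at with unique-split A a B b S (subst Unique π≡ u)
  ... | _ ∷ uS , _ , _ =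
    trans (count-positions S (suc (length P)) _ _ at-k)
          (countSplits-132 a (guard132 T A a B b) (λ {c} → <ᵇ-true⁻ ∘ ∧-conicalˡ (a <ᵇ c) _ ∘ ∧-conicalˡ _ _) [] S uS)
    where
      at-k : ∀ C c D → C ++ c ∷ D ≡ S →
        isOccurrence (p132 T) π (suc (length A) ∷ suc (length P) ∷ suc (suc (length P + length C)) ∷ [])
        ≡ all (between a c) C ∧ (guard132 T A a B b c ∧ all (between a c) D)
      at-k C c D S≡ with fresh C c D S≡
      ... | a≢b , b≢c , a≢c , fA , fC , fD =
        trans (occurs (1 ∷ 3 ∷ 2 ∷ []) C c D S≡) (occursAt-132 T lowerLeft a≢b b≢c a≢c fA fC fD)

Φ-preserves-S : ∀ {π} → Unique π → InRange (length π) π → Unique (Φ π) × InRange (length (Φ π)) (Φ π)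
Φ-preserves-S {π} u inRange =
  Unique-resp-↭ (↭-sym Φπ↭π) u ,
  λ v∈ → subst (λ n → 0 < _ × _ ≤ n) (sym (↭-length Φπ↭π)) (inRange (∈-resp-↭ Φπ↭π v∈))
  where Φπ↭π = Φ-↭ π u

record ΦSplit (A : List ℕ) (a : ℕ) (B : List ℕ) (b : ℕ) (S : List ℕ) : Set where
  field
    A′ : List ℕ
    a′ : ℕ
    B′ : List ℕ
    b′ : ℕ
    S′ : List ℕ
    Φ≡ : Φ ((A ++ a ∷ B) ++ b ∷ S) ≡ (A′ ++ a′ ∷ B′) ++ b′ ∷ S′
    A≈ : Pointwise (AgreeUpTo (secondLargest (b ∷ S))) A A′
    a≈ : AgreeUpTo (secondLargest (b ∷ S)) a a′
    B≈ : Pointwise (AgreeUpTo (secondLargest (b ∷ S))) B B′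
    W≈ : Pointwise (AgreeUpTo (secondLargest (b ∷ S))) (Φ (b ∷ S)) (b′ ∷ S′)

Φ-split : ∀ A a B b S → Unique ((A ++ a ∷ B) ++ b ∷ S) → Positive ((A ++ a ∷ B) ++ b ∷ S) → ΦSplit A a B b S
Φ-split A a B b S u pos with Pointwise-++⁻ (A ++ a ∷ B) (Φ-++ (A ++ a ∷ B) b S u pos)
... | _ , W′ , Φ≡ , P≈ , W≈ with Pointwise-++⁻ A P≈ | Φ-∷-shape b S
...   | A′ , a′ ∷ B′ , refl , A≈ , a≈ ∷ B≈ | _ , _ , ΦW≡
  with subst (λ W → Pointwise (AgreeUpTo (secondLargest (b ∷ S))) W W′) ΦW≡ W≈
...     | _ ∷ _ = record { A′ = A′ ; a′ = a′ ; B′ = B′ ; Φ≡ = Φ≡ ; A≈ = A≈ ; a≈ = a≈ ; B≈ = B≈ ; W≈ = W≈ }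

occurrences-at-Φ : ∀ T → All LowerLeft T → ∀ {π} A a B b S → π ≡ (A ++ a ∷ B) ++ b ∷ S →
  Unique π → InRange (length π) π →
  count (λ k → isOccurrence (p123 T) π (suc (length A) ∷ suc (length (A ++ a ∷ B)) ∷ k ∷ []))
        (interval (suc (suc (length (A ++ a ∷ B)))) (length S))
  ≡ count (λ k → isOccurrence (p132 T) (Φ π) (suc (length A) ∷ suc (length (A ++ a ∷ B)) ∷ k ∷ []))
          (interval (suc (suc (length (A ++ a ∷ B)))) (length S))
occurrences-at-Φ T lowerLeft {π} A a B b S refl u inRange = begin
  count (occurs123 (length A) (length (A ++ a ∷ B))) (interval (suc (suc (length (A ++ a ∷ B)))) (length S))
    ≡⟨ occurrences-123-at T lowerLeft A a B b S (++-assoc A (a ∷ B) (b ∷ S)) u inRange ⟩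
  indicator (completes123 T A a B b S)
    ≡⟨ cong indicator (completes123≡completes132-Φ T lowerLeft uW a≢b (proj₁ (inRange b∈)) A≈ a≈ B≈ W≈) ⟩
  indicator (completes132 T A′ a′ B′ b′ S′)
    ≡⟨ occurrences-132-at T lowerLeft A′ a′ B′ b′ S′ (trans Φ≡ (++-assoc A′ (a′ ∷ B′) (b′ ∷ S′))) uΦ inRangeΦ ⟨
  count (occurs132 (length A′) (length (A′ ++ a′ ∷ B′))) (interval (suc (suc (length (A′ ++ a′ ∷ B′)))) (length S′))
    ≡⟨ cong₃ (λ i j d → count (occurs132 i j) (interval (suc (suc j)) d))
             (Pointwise.Pointwise-length A≈) (Pointwise.Pointwise-length (Pointwise.++⁺ A≈ (a≈ ∷ B≈)))
             (suc-injective (trans (sym (↭-length (Φ-↭ (b ∷ S) uW))) (Pointwise.Pointwise-length W≈))) ⟨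
  count (occurs132 (length A) (length (A ++ a ∷ B))) (interval (suc (suc (length (A ++ a ∷ B)))) (length S)) ∎
  where
    open ≡-Reasoning
    open ΦSplit (Φ-split A a B b S u (proj₁ ∘ inRange))
    occurs123 occurs132 : ℕ → ℕ → ℕ → Bool
    occurs123 i j k = isOccurrence (p123 T) π (suc i ∷ suc j ∷ k ∷ [])
    occurs132 i j k = isOccurrence (p132 T) (Φ π) (suc i ∷ suc j ∷ k ∷ [])
    uW = proj₁ (unique-split A a B b S (subst Unique (++-assoc A (a ∷ B) (b ∷ S)) u))
    a≢b = proj₂ (proj₂ (unique-split A a B b S (subst Unique (++-assoc A (a ∷ B) (b ∷ S)) u)))
    b∈ : b ∈ π
    b∈ = ∈-++⁺ʳ (A ++ a ∷ B) (here refl)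
    uΦ : Unique (Φ π)
    uΦ = proj₁ (Φ-preserves-S u inRange)
    inRangeΦ : InRange (length (Φ π)) (Φ π)
    inRangeΦ = proj₂ (Φ-preserves-S u inRange)
    cong₃ : ∀ (f : ℕ → ℕ → ℕ → ℕ) {x x′ y y′ z z′} → x ≡ x′ → y ≡ y′ → z ≡ z′ → f x y z ≡ f x′ y′ z′
    cong₃ f refl refl refl = refl

length-suffix : ∀ (P : List ℕ) b S {d} → length P + suc d ≡ length (P ++ b ∷ S) → d ≡ length S
length-suffix P b S {d} eq = suc-injective (+-cancelˡ-≡ (length P) (suc d) (suc (length S)) (trans eq (length-++ P)))

occurrences-at-positions-Φ : ∀ T → All LowerLeft T → ∀ {π} → Unique π → InRange (length π) π →
  ∀ i j d → i < j → j + suc d ≡ length π →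
  count (λ k → isOccurrence (p123 T) π (suc i ∷ suc j ∷ k ∷ [])) (interval (suc (suc j)) d)
  ≡ count (λ k → isOccurrence (p132 T) (Φ π) (suc i ∷ suc j ∷ k ∷ [])) (interval (suc (suc j)) d)
occurrences-at-positions-Φ T lowerLeft {π} u inRange i j d i<j j+d≡
  with split-at π j (subst (j <_) j+d≡ (m<m+n j (s≤s z≤n)))
... | P , b , S , π≡ , refl with split-at P i i<j
...   | A , a , B , refl , refl rewrite length-suffix (A ++ a ∷ B) b S (trans j+d≡ (cong length π≡)) =
  occurrences-at-Φ T lowerLeft A a B b S π≡ u inRange

count-choose-1 : ∀ (f : List ℕ → Bool) l → count f (choose 1 l) ≡ count (f ∘ [_]) l
count-choose-1 f []      = refl
count-choose-1 f (x ∷ l) = cong (indicator (f [ x ]) +_) (count-choose-1 f l)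

count-choose-cong : ∀ r s c (f g : List ℕ → Bool) →
  (∀ i d → s ≤ i → i + suc d ≡ s + c →
     count (f ∘ (i ∷_)) (choose r (interval (suc i) d)) ≡ count (g ∘ (i ∷_)) (choose r (interval (suc i) d))) →
  count f (choose (suc r) (interval s c)) ≡ count g (choose (suc r) (interval s c))
count-choose-cong r s zero    f g _      = refl
count-choose-cong r s (suc c) f g heads≡ = begin
  count f (map (s ∷_) (choose r I) ++ choose (suc r) I)          ≡⟨ count-++ f (map (s ∷_) (choose r I)) _ ⟩
  count f (map (s ∷_) (choose r I)) + count f (choose (suc r) I)  ≡⟨ cong₂ _+_ head tail ⟩
  count g (map (s ∷_) (choose r I)) + count g (choose (suc r) I)  ≡⟨ count-++ g (map (s ∷_) (choose r I)) _ ⟨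
  count g (map (s ∷_) (choose r I) ++ choose (suc r) I)          ∎
  where
    open ≡-Reasoning
    I = interval (suc s) c
    head : count f (map (s ∷_) (choose r I)) ≡ count g (map (s ∷_) (choose r I))
    head = trans (count-map f (s ∷_) (choose r I))
                 (trans (heads≡ s c ≤-refl refl) (sym (count-map g (s ∷_) (choose r I))))
    tail : count f (choose (suc r) I) ≡ count g (choose (suc r) I)
    tail = count-choose-cong r (suc s) c f g (λ i d s<i i+d≡ → heads≡ i d (<⇒≤ s<i) (trans i+d≡ (sym (+-suc s c))))

occ123≡occ132-Φ : ∀ T → All LowerLeft T → ∀ π → Unique π → InRange (length π) π → occ (p123 T) π ≡ occ (p132 T) (Φ π)
occ123≡occ132-Φ T lowerLeft π u inRange = begin
  occ (p123 T) π
    ≡⟨ count-filter (isOccurrence (p123 T) π) (choose 3 (range1 (length π))) ⟩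
  count (isOccurrence (p123 T) π) (choose 3 (range1 (length π)))
    ≡⟨ cong (count (isOccurrence (p123 T) π) ∘ choose 3) (range1≡interval (length π)) ⟩
  count (isOccurrence (p123 T) π) (choose 3 (interval 1 (length π)))
    ≡⟨ count-choose-cong 2 1 (length π) _ _ (λ i d 1≤i i+d≡ →
         count-choose-cong 1 (suc i) d _ _ (λ j d′ i<j j+d′≡ →
           pair i j d′ 1≤i i<j (trans j+d′≡ (trans (sym (+-suc i d)) i+d≡)))) ⟩
  count (isOccurrence (p132 T) (Φ π)) (choose 3 (interval 1 (length π)))
    ≡⟨ cong (count (isOccurrence (p132 T) (Φ π)) ∘ choose 3)
            (trans (cong range1 (↭-length (Φ-↭ π u))) (range1≡interval (length π))) ⟨
  count (isOccurrence (p132 T) (Φ π)) (choose 3 (range1 (length (Φ π))))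
    ≡⟨ count-filter (isOccurrence (p132 T) (Φ π)) (choose 3 (range1 (length (Φ π)))) ⟨
  occ (p132 T) (Φ π) ∎
  where
    open ≡-Reasoning
    pair : ∀ i j d → 1 ≤ i → suc i ≤ j → j + suc d ≡ suc (length π) →
      count (λ l → isOccurrence (p123 T) π (i ∷ j ∷ l)) (choose 1 (interval (suc j) d))
      ≡ count (λ l → isOccurrence (p132 T) (Φ π) (i ∷ j ∷ l)) (choose 1 (interval (suc j) d))
    pair (suc i) (suc j) d _ (s≤s i<j) j+d≡ =
      trans (count-choose-1 _ (interval (suc (suc j)) d))
            (trans (occurrences-at-positions-Φ T lowerLeft u inRange i j d i<j (suc-injective j+d≡))
                   (sym (count-choose-1 _ (interval (suc (suc j)) d))))

∈-range1 : ∀ {v} n → v ∈ range1 n → 0 < v × v ≤ n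
∈-range1 n v∈ with ∈-interval 1 n (subst (_ ∈_) (range1≡interval n) v∈)
... | 0<v , v<1+n = 0<v , ≤-pred v<1+n

∈-range1⁺ : ∀ {v} n → 0 < v → v ≤ n → v ∈ range1 n
∈-range1⁺ n 0<v v≤n = subst (_ ∈_) (sym (range1≡interval n)) (∈-interval⁺ 1 n 0<v (s≤s v≤n))

Unique-interval : ∀ s c → Unique (interval s c)
Unique-interval s zero    = []
Unique-interval s (suc c) =
  All.tabulate (λ v∈ s≡v → <-irrefl s≡v (proj₁ (∈-interval (suc s) c v∈))) ∷ Unique-interval (suc s) c

Unique-range1 : ∀ n → Unique (range1 n)
Unique-range1 n = subst Unique (sym (range1≡interval n)) (Unique-interval 1 n)

∈-words : ∀ (A : List ℕ) m {w} → w ∈ words A m → length w ≡ m × All (_∈ A) w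
∈-words A zero    (here refl) = refl , []
∈-words A (suc m) w∈ with find (∈-concatMap⁻ (λ a → map (a ∷_) (words A m)) {xs = A} w∈)
... | a , a∈A , w∈′ with ∈-map⁻ (a ∷_) w∈′
...   | w′ , w′∈ , refl with ∈-words A m w′∈
...     | |w′| , w′⊆A = cong suc |w′| , a∈A ∷ w′⊆A

∈-words⁺ : ∀ (A : List ℕ) {w} → All (_∈ A) w → w ∈ words A (length w)
∈-words⁺ A []                        = here refl
∈-words⁺ A {x ∷ w} (a∈A ∷ w⊆A) =
  ∈-concatMap⁺ (λ a → map (a ∷_) (words A (length w))) (lose a∈A (∈-map⁺ (x ∷_) (∈-words⁺ A w⊆A)))

Unique-words : ∀ (A : List ℕ) m → Unique A → Unique (words A m)
Unique-words A zero    _  = [] ∷ []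
Unique-words A (suc m) uA = go A uA
  where
    W = words A m
    go : ∀ B → Unique B → Unique (concatMap (λ a → map (a ∷_) W) B)
    go []      _          = []
    go (a ∷ B) (a∉ ∷ uB) = Unique.++⁺ (Unique.map⁺ ∷-injectiveʳ (Unique-words A m uA)) (go B uB) disjoint
      where
        disjoint : ∀ {v} → ¬ (v ∈ map (a ∷_) W × v ∈ concatMap (λ a → map (a ∷_) W) B)
        disjoint (v∈ , v∈′) with ∈-map⁻ (a ∷_) v∈ | find (∈-concatMap⁻ (λ a → map (a ∷_) W) {xs = B} v∈′)
        ... | _ , _ , refl | a′ , a′∈B , v∈″ with ∈-map⁻ (a′ ∷_) v∈″
        ...   | _ , _ , refl = All¬⇒¬Any a∉ a′∈B

elem-false : ∀ x xs → elem x xs ≡ false → x ∉ xs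
elem-false x (y ∷ xs) eq (here refl) rewrite ≡ᵇ-true {x} refl with () ← eq
elem-false x (y ∷ xs) eq (there x∈) with x ≡ᵇ y
... | false = elem-false x xs eq x∈

elem-false⁺ : ∀ x xs → x ∉ xs → elem x xs ≡ false
elem-false⁺ x []       _  = refl
elem-false⁺ x (y ∷ xs) x∉ rewrite ≡ᵇ-false (x∉ ∘ here) = elem-false⁺ x xs (x∉ ∘ there)

distinct⇒Unique : ∀ w → distinct w ≡ true → Unique w
distinct⇒Unique []      _  = []
distinct⇒Unique (x ∷ w) eq with elem x w in x∈?
... | false = ¬Any⇒All¬ w (elem-false x w x∈?) ∷ distinct⇒Unique w eq

Unique⇒distinct : ∀ w → Unique w → distinct w ≡ true
Unique⇒distinct []      _          = refl
Unique⇒distinct (x ∷ w) (x∉ ∷ u) rewrite elem-false⁺ x w (All¬⇒¬Any x∉) = Unique⇒distinct w u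

∈-Sn : ∀ n {π} → π ∈ Sn n → length π ≡ n × Unique π × InRange n π
∈-Sn n {π} π∈ with ∈-filter⁻ (λ w → T? (distinct w)) {xs = words (range1 n) n} π∈
... | π∈words , distinctπ with ∈-words (range1 n) n π∈words
...   | |π| , π⊆range =
  |π| , distinct⇒Unique π (Equivalence.to T-≡ distinctπ) , λ v∈ → ∈-range1 n (All.lookup π⊆range v∈)

∈-Sn⁺ : ∀ {π} → Unique π → InRange (length π) π → π ∈ Sn (length π)
∈-Sn⁺ {π} u inRange = ∈-filter⁺ (λ w → T? (distinct w)) {xs = words (range1 (length π)) (length π)}
  (∈-words⁺ (range1 (length π))
            (All.tabulate (λ v∈ → ∈-range1⁺ (length π) (proj₁ (inRange v∈)) (proj₂ (inRange v∈)))))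
  (Equivalence.from T-≡ (Unique⇒distinct π u))

Unique-Sn : ∀ n → Unique (Sn n)
Unique-Sn n = Unique.filter⁺ (λ w → T? (distinct w)) (Unique-words (range1 n) n (Unique-range1 n))

Φ-∈-Sn : ∀ n {π} → π ∈ Sn n → Φ π ∈ Sn n
Φ-∈-Sn n {π} π∈ with ∈-Sn n π∈
... | refl , u , inRange = subst (λ m → Φ π ∈ Sn m) (↭-length (Φ-↭ π u)) (∈-Sn⁺ (proj₁ Φπ∈S) (proj₂ Φπ∈S))
  where Φπ∈S = Φ-preserves-S u inRange

Φ-involutive-Sn : ∀ n {π} → π ∈ Sn n → Φ (Φ π) ≡ π
Φ-involutive-Sn n π∈ with ∈-Sn n π∈
... | _ , u , inRange = Φ-involutive _ u (proj₁ ∘ inRange)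

lowerLeft? : Decidable LowerLeft
lowerLeft? (c , r) = (c ≤? 1) ×-dec (r ≤? 1)

Ts-lowerLeft : All (All LowerLeft) Ts
Ts-lowerLeft = toWitness {a? = All.all? (All.all? lowerLeft?) Ts} _

theorem4p9 : ∀ T → T ∈ Ts → p123 T ∼d p132 T
theorem4p9 T T∈ n ℓ = begin
  length (filter (λ π → occ (p123 T) π ≟ ℓ) (Sn n))
    ≡⟨ length-filter-cong (occ (p123 T)) (occ (p132 T) ∘ Φ) ℓ (Sn n) occ≡ ⟩
  length (filter (λ π → occ (p132 T) (Φ π) ≟ ℓ) (Sn n))
    ≡⟨ length-filter-map (λ π → occ (p132 T) π ≟ ℓ) Φ (Sn n) ⟨
  length (filter (λ π → occ (p132 T) π ≟ ℓ) (map Φ (Sn n)))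
    ≡⟨ ↭-length (↭.filter-↭ (λ π → occ (p132 T) π ≟ ℓ)
                            (map-involution-↭ (Unique-Sn n) (Φ-∈-Sn n) (Φ-involutive-Sn n))) ⟩
  length (filter (λ π → occ (p132 T) π ≟ ℓ) (Sn n)) ∎
  where
    open ≡-Reasoning
    occ≡ : ∀ {π} → π ∈ Sn n → occ (p123 T) π ≡ occ (p132 T) (Φ π)
    occ≡ π∈ with ∈-Sn n π∈
    ... | refl , u , inRange = occ123≡occ132-Φ T (All.lookup Ts-lowerLeft T∈) _ u inRange
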